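{- Let $T$ be a tree with $n$ vertices and let $d\ge 1$ be an integer. Then for every positive integer $k$, $$\pi_T^{(Q_d)}(k) = \frac{1}{2^d}\sum_{S\subseteq V(T),\ |S|=d} k(k-1)^{n+d-1-\deg(S)}(k-2)^{\deg(S)-\operatorname{int}(S)}(k-3)^{\operatorname{int}(S)},$$ where $\deg(S)=\sum_{v\in S}\deg(v)$ and $\operatorname{int}(S)$ is the number of edges of $T$ with both endpoints in $S$.
   Context: $Q_d = K_2\,\square\,K_2\,\square\cdots\square\,K_2$ ($d$ factors) is the $d$-dimensional hypercube graph, where $\square$ is the Cartesian product of graphs. For a positive integer $k$, a proper $k$-coloring of a graph $G$ is a map $V(G)\to\{1,\dots,k\}$ giving adjacent vertices different colors. The $k$-coloring graph $\mathcal{C}_k(G)$ has the proper $k$-colorings of $G$ as vertices, two colorings adjacent iff they differ in the color of exactly one vertex. For a graph $H$, $\pi_G^{(H)}(k)$ is the number of vertex subsets $U$ of $\mathcal{C}_k(G)$ whose induced subgraph is isomorphic to $H$. -}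

module Defs where

open import Data.Nat using (ℕ; zero; suc; _+_; _*_; _∸_; _^_; _≤_)
open import Data.Integer as ℤ using (ℤ; +_)
open import Data.Bool using (Bool; true; false)
import Data.Bool.Properties as BoolP
open import Data.Fin using (Fin; zero; suc; inject₁; fromℕ; _<_; _<?_)
import Data.Fin.Properties as FinP
open import Data.Fin.Subset using (Subset; _∈_; ∣_∣)
open import Data.Fin.Subset.Properties using (_∈?_)
open import Data.Nat.ListAction using (sum)
open import Data.Vec using (Vec; []; _∷_; lookup)
open import Data.List as List using (List; []; _∷_; _++_; filter; length; allFin; cartesianProduct)
open import Data.Product using (Σ; ∃; _×_; _,_; proj₁; proj₂)
open import Data.Irrelevant using (Irrelevant)
open import Relation.Binary.PropositionalEquality using (_≡_)
open import Relation.Binary.Definitions using (DecidableEquality)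
open import Relation.Nullary using (¬_; Dec; yes; no; ¬?)
open import Relation.Nullary.Decidable using (_→-dec_; _×-dec_)
open import Relation.Unary using (Decidable)
open import Function.Bundles using (_⇔_; _↔_)

record SimpleGraph (n : ℕ) : Set₁ where
  field
    Adj    : Fin n → Fin n → Set
    adj?   : (u v : Fin n) → Dec (Adj u v)
    sym    : ∀ {u v} → Adj u v → Adj v u
    irrefl : ∀ {u} → ¬ Adj u u

module _ {n : ℕ} (G : SimpleGraph n) where
  open SimpleGraph G

  data Walk : Fin n → Fin n → Set where
    nil  : ∀ {u} → Walk u u
    cons : ∀ {u v w} → Adj u v → Walk v w → Walk u w

  Connected : Set
  Connected = ∀ u v → Walk u v

  record Cycle : Set where
    field
      len      : ℕ
      vert     : Fin (suc (suc (suc len))) → Fin n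
      distinct : ∀ i j → vert i ≡ vert j → i ≡ j
      step     : ∀ (i : Fin (suc (suc len))) → Adj (vert (inject₁ i)) (vert (suc i))
      close    : Adj (vert (fromℕ (suc (suc len)))) (vert zero)

  Acyclic : Set
  Acyclic = ¬ Cycle

  IsTree : Set
  IsTree = Connected × Acyclic

  deg : Fin n → ℕ
  deg v = length (filter (adj? v) (allFin n))

  degS : Subset n → ℕ
  degS S = sum (List.map deg (filter (_∈? S) (allFin n)))

  intS : Subset n → ℕ
  intS S = length (filter P? (cartesianProduct (allFin n) (allFin n)))
    where
      P? : (p : Fin n × Fin n) → Dec ((proj₁ p < proj₂ p) × ((proj₁ p ∈ S) × ((proj₂ p ∈ S) × Adj (proj₁ p) (proj₂ p))))
      P? (u , v) = (u <? v) ×-dec ((u ∈? S) ×-dec ((v ∈? S) ×-dec adj? u v))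

hamming : {A : Set} → DecidableEquality A → {m : ℕ} → Vec A m → Vec A m → ℕ
hamming _≟_ [] [] = 0
hamming _≟_ (x ∷ xs) (y ∷ ys) with x ≟ y
... | yes _ = hamming _≟_ xs ys
... | no  _ = suc (hamming _≟_ xs ys)

-- The hypercube Q_d = K₂ □ ⋯ □ K₂ : vertices Bool^d, adjacent iff they
-- differ in exactly one coordinate

QAdj : {d : ℕ} → Vec Bool d → Vec Bool d → Set
QAdj x y = hamming BoolP._≟_ x y ≡ 1

-- Colourings: maps V(G) → {1..k}, represented as Vec (Fin k) n

allVecs : (k n : ℕ) → List (Vec (Fin k) n)
allVecs k zero    = [] ∷ []
allVecs k (suc n) = List.concatMap (λ c → List.map (c ∷_) (allVecs k n)) (allFin k)

module _ {n : ℕ} (G : SimpleGraph n) where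
  open SimpleGraph G

  Proper : {k : ℕ} → Vec (Fin k) n → Set
  Proper c = ∀ u v → Adj u v → ¬ (lookup c u ≡ lookup c v)

  proper? : {k : ℕ} → (c : Vec (Fin k) n) → Dec (Proper c)
  proper? c = FinP.all? λ u → FinP.all? λ v → adj? u v →-dec ¬? (lookup c u FinP.≟ lookup c v)

  -- the vertices of the k-colouring graph C_k(G), listed without repetition
  properCols : (k : ℕ) → List (Vec (Fin k) n)
  properCols k = filter proper? (allVecs k n)

  nCols : ℕ → ℕ
  nCols k = length (properCols k)

  col : (k : ℕ) → Fin (nCols k) → Vec (Fin k) n
  col k i = List.lookup (properCols k) i

  CAdj : (k : ℕ) → Fin (nCols k) → Fin (nCols k) → Set
  CAdj k i j = hamming FinP._≟_ (col k i) (col k j) ≡ 1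

  InducedIsoQ : (k d : ℕ) → Subset (nCols k) → Set
  InducedIsoQ k d U =
    Σ (Vec Bool d → Fin (nCols k)) λ φ →
      (∀ x y → φ x ≡ φ y → x ≡ y) ×
      ((∀ i → i ∈ U ⇔ ∃ λ x → φ x ≡ i) ×
       (∀ x y → QAdj x y ⇔ CAdj k (φ x) (φ y)))

  -- vertex subsets U of C_k(G) with C_k(G)[U] ≅ Q_d
  -- (isomorphism witness squashed, so that each subset is counted once)
  QSubsets : (k d : ℕ) → Set
  QSubsets k d = Σ (Subset (nCols k)) λ U → Irrelevant (InducedIsoQ k d U)

  PiQ≡ : (k d N : ℕ) → Set
  PiQ≡ k d N = Fin N ↔ QSubsets k d

-- right-hand side of Theorem 4.3 (without the factor 1/2^d), over ℤ

allSubsets : (n : ℕ) → List (Subset n)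
allSubsets zero    = [] ∷ []
allSubsets (suc n) = List.map (false ∷_) (allSubsets n) ++ List.map (true ∷_) (allSubsets n)

sumℤ : List ℤ → ℤ
sumℤ = List.foldr ℤ._+_ (+ 0)

module _ {n : ℕ} (T : SimpleGraph n) where

  term : ℕ → ℕ → Subset n → ℤ
  term k d S =
    + k ℤ.* ((+ k ℤ.- + 1) ℤ.^ (n + d ∸ 1 ∸ degS T S))
        ℤ.* ((+ k ℤ.- + 2) ℤ.^ (degS T S ∸ intS T S))
        ℤ.* ((+ k ℤ.- + 3) ℤ.^ intS T S)

  treeSum : ℕ → ℕ → ℤ
  treeSum k d = sumℤ (List.map (term k d) (filter (λ S → ∣ S ∣ Data.Nat.≟ d) (allSubsets n)))

-- An induced copy of Q_d in the colouring graph C_k(T) is a box: there are d distinct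
-- vertices v₁ … v_d of T, each with two colours {αᵢ, βᵢ}, every other vertex keeps one colour,
-- and the 2^d colourings choose αᵢ or βᵢ at every vᵢ.  This rests on the observation that an
-- induced 4-cycle of a Hamming graph recolours the same vertex along opposite edges.  Writing
-- each box as a state vector (a sorted pair of colours on S = {vᵢ}, a single colour elsewhere),
-- boxes are exactly the state vectors with disjoint states at adjacent vertices, and |S| = d.
-- These are counted by growing T from a root in S one leaf at a time: a leaf has k − 1, k − 2,
-- C(k−1,2) or C(k−2,2) states compatible with its parent's, according to whether it and its
-- parent lie in S.  The factor 2^d turns each C(m,2) into m(m − 1), and summing the exponents
-- over the edges produces deg(S) and int(S).

module Submission where

open import Defs

import Algebra.Properties.CommutativeSemigroup
open import Data.Bool using (Bool; true; false; not; _∨_; if_then_else_)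
import Data.Bool.Properties as Bool
open import Data.Empty using (⊥; ⊥-elim)
import Data.Empty.Irrelevant as Irrelevant
open import Data.Fin as Fin using (Fin; zero; suc; punchIn; punchOut; inject₁; fromℕ)
import Data.Fin.Properties as Fin
open import Data.Fin.Subset using (Subset; ∣_∣)
import Data.Fin.Subset as Subset
open import Data.Fin.Subset.Properties using (_∈?_)
open import Data.Integer as ℤ using (ℤ; +_)
import Data.Integer.Properties as ℤ
import Data.Integer.Solver
open import Data.Irrelevant using (Irrelevant; [_])
open import Data.List as List using (List; []; _∷_; _++_; map; concatMap; filter; length; allFin; cartesianProduct; cartesianProductWith)
open import Data.List.Membership.Propositional using (_∈_; lose; find)
open import Data.List.Membership.Propositional.Properties
  using (∈-map⁻; ∈-map⁺; ∈-++⁺ˡ; ∈-++⁺ʳ; ∈-allFin; ∈-concatMap⁺; ∈-concatMap⁻; ∈-filter⁺; ∈-filter⁻; ∈-lookup;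
         ∈-cartesianProductWith⁺; ∈-cartesianProductWith⁻)
import Data.List.Membership.DecPropositional as DecMembership
open import Data.List.Relation.Unary.All as All using (All; []; _∷_)
import Data.List.Relation.Unary.All.Properties as All
open import Data.List.Relation.Unary.AllPairs as AllPairs using ([]; _∷_)
import Data.List.Relation.Unary.AllPairs.Properties as AllPairs
open import Data.List.Relation.Unary.Any as Any using (Any; here; there; index)
open import Data.List.Relation.Unary.Any.Properties using (lookup-index)
open import Data.List.Relation.Unary.Linked using (Linked; [-]; _∷_)
open import Data.List.Relation.Unary.Unique.Propositional using (Unique)
import Data.List.Relation.Unary.Unique.Propositional.Properties as Unique
open import Data.Nat as ℕ using (ℕ; zero; suc; _+_; _*_; _∸_; _^_; _≤_; z≤n; s≤s; pred)
open import Data.Nat.Combinatorics using (_C_; nC1≡n; nCk+nC[k+1]≡[n+1]C[k+1])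
open import Data.Nat.ListAction using (sum)
open import Data.Nat.Properties
open import Algebra.Properties.Semiring.Sum +-*-semiring
  using (sum-syntax; sum-cong-≗; ∑-distrib-+; ∑-comm; *-distribˡ-sum; sum-replicate-zero)
import Data.Nat.Solver
open import Data.Product using (Σ; ∃; _×_; _,_; proj₁; proj₂)
open import Data.Sum as Sum using (_⊎_; inj₁; inj₂)
open import Data.Vec as Vec using (Vec; []; _∷_; lookup; tabulate; replicate; insertAt; updateAt; _[_]≔_)
import Data.Vec.Properties as Vec
open import Function using (_∘_; id; _⇔_; mk⇔)
open import Function.Bundles using (Equivalence; _↔_; mk↔ₛ′)
open import Relation.Binary.Definitions using (DecidableEquality; tri<; tri≈; tri>)
open import Relation.Binary.PropositionalEquality
open import Relation.Nullary using (¬_; Dec; yes; no; does; contradiction)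
open import Relation.Nullary.Decidable using (_×-dec_; _⊎-dec_; _→-dec_; ¬?; dec-true; dec-false)
open import Relation.Unary using (Decidable)

open ≡-Reasoning

module +-Semigroup = Algebra.Properties.CommutativeSemigroup +-commutativeSemigroup
module *-Semigroup = Algebra.Properties.CommutativeSemigroup *-commutativeSemigroup
module ℕ-Solver = Data.Nat.Solver.+-*-Solver
module ℤ-Solver = Data.Integer.Solver.+-*-Solver

private variable
  A B : Set
  P Q : Set
  n : ℕ

𝟙 : Bool → ℕ
𝟙 true  = 1
𝟙 false = 0

χ : Dec P → ℕ
χ p = 𝟙 (does p)

χ-cong : (p : Dec P) (q : Dec Q) → (P → Q) → (Q → P) → χ p ≡ χ q
χ-cong (yes _) (yes _) _ _ = refl
χ-cong (no _)  (no _)  _ _ = refl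
χ-cong (yes x) (no ¬y) f _ = contradiction (f x) ¬y
χ-cong (no ¬x) (yes y) _ g = contradiction (g y) ¬x

does-true⇒ : (p : Dec P) → does p ≡ true → P
does-true⇒ (yes x) _ = x

χ-yes : (p : Dec P) → P → χ p ≡ 1
χ-yes (yes _) _ = refl
χ-yes (no ¬x) x = contradiction x ¬x

χ-no : (p : Dec P) → ¬ P → χ p ≡ 0
χ-no (yes x) ¬x = contradiction x ¬x
χ-no (no _)  _  = refl

χ-× : (p : Dec P) (q : Dec Q) → χ (p ×-dec q) ≡ χ p * χ q
χ-× (yes _) (yes _) = refl
χ-× (yes _) (no _)  = refl
χ-× (no _)  (yes _) = refl
χ-× (no _)  (no _)  = refl

listSum : List A → (A → ℕ) → ℕ
listSum []       f = 0
listSum (x ∷ xs) f = f x + listSum xs f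

syntax listSum xs (λ x → e) = ∑[ x ∈ xs ] e

∑ₗ-cong : ∀ (xs : List A) {f g : A → ℕ} → (∀ x → f x ≡ g x) → listSum xs f ≡ listSum xs g
∑ₗ-cong []       _ = refl
∑ₗ-cong (x ∷ xs) e = cong₂ _+_ (e x) (∑ₗ-cong xs e)

∑ₗ-cong-∈ : ∀ (xs : List A) {f g : A → ℕ} → (∀ {x} → x ∈ xs → f x ≡ g x) → listSum xs f ≡ listSum xs g
∑ₗ-cong-∈ []       _ = refl
∑ₗ-cong-∈ (x ∷ xs) e = cong₂ _+_ (e (here refl)) (∑ₗ-cong-∈ xs (e ∘ there))

∑ₗ-zero : ∀ (xs : List A) → ∑[ x ∈ xs ] 0 ≡ 0
∑ₗ-zero []       = refl
∑ₗ-zero (_ ∷ xs) = ∑ₗ-zero xs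

∑ₗ-distrib-+ : ∀ (xs : List A) (f g : A → ℕ) → ∑[ x ∈ xs ] (f x + g x) ≡ listSum xs f + listSum xs g
∑ₗ-distrib-+ []       f g = refl
∑ₗ-distrib-+ (x ∷ xs) f g = begin
  f x + g x + ∑[ y ∈ xs ] (f y + g y)         ≡⟨ cong (_+_ (f x + g x)) (∑ₗ-distrib-+ xs f g) ⟩
  f x + g x + (listSum xs f + listSum xs g)   ≡⟨ +-Semigroup.interchange (f x) (g x) _ _ ⟩
  f x + listSum xs f + (g x + listSum xs g)   ∎

*-distribˡ-∑ₗ : ∀ c (xs : List A) (f : A → ℕ) → c * listSum xs f ≡ ∑[ x ∈ xs ] (c * f x)
*-distribˡ-∑ₗ c []       f = *-zeroʳ c
*-distribˡ-∑ₗ c (x ∷ xs) f = trans (*-distribˡ-+ c (f x) _) (cong (_+_ (c * f x)) (*-distribˡ-∑ₗ c xs f))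

∑ₗ-++ : ∀ (xs ys : List A) (f : A → ℕ) → listSum (xs ++ ys) f ≡ listSum xs f + listSum ys f
∑ₗ-++ []       ys f = refl
∑ₗ-++ (x ∷ xs) ys f = trans (cong (_+_ (f x)) (∑ₗ-++ xs ys f)) (sym (+-assoc (f x) _ _))

∑ₗ-map : ∀ (g : A → B) (xs : List A) (f : B → ℕ) → listSum (map g xs) f ≡ ∑[ x ∈ xs ] f (g x)
∑ₗ-map g []       f = refl
∑ₗ-map g (x ∷ xs) f = cong (_+_ (f (g x))) (∑ₗ-map g xs f)

∑ₗ-concatMap : ∀ (g : A → List B) (xs : List A) (f : B → ℕ) →
  listSum (concatMap g xs) f ≡ ∑[ x ∈ xs ] listSum (g x) f
∑ₗ-concatMap g []       f = refl
∑ₗ-concatMap g (x ∷ xs) f = trans (∑ₗ-++ (g x) _ f) (cong (_+_ (listSum (g x) f)) (∑ₗ-concatMap g xs f))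

∑ₗ-cartesianProductWith : ∀ {C : Set} (g : A → B → C) (xs : List A) (ys : List B) (f : C → ℕ) →
  listSum (cartesianProductWith g xs ys) f ≡ ∑[ x ∈ xs ] ∑[ y ∈ ys ] f (g x y)
∑ₗ-cartesianProductWith g []       ys f = refl
∑ₗ-cartesianProductWith g (x ∷ xs) ys f = begin
  listSum (map (g x) ys ++ cartesianProductWith g xs ys) f
    ≡⟨ ∑ₗ-++ (map (g x) ys) _ f ⟩
  listSum (map (g x) ys) f + listSum (cartesianProductWith g xs ys) f
    ≡⟨ cong₂ _+_ (∑ₗ-map (g x) ys f) (∑ₗ-cartesianProductWith g xs ys f) ⟩
  ∑[ y ∈ ys ] f (g x y) + ∑[ x′ ∈ xs ] ∑[ y ∈ ys ] f (g x′ y) ∎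

∑ₗ-comm : ∀ (xs : List A) (ys : List B) (f : A → B → ℕ) →
  ∑[ x ∈ xs ] ∑[ y ∈ ys ] f x y ≡ ∑[ y ∈ ys ] ∑[ x ∈ xs ] f x y
∑ₗ-comm []       ys f = sym (∑ₗ-zero ys)
∑ₗ-comm (x ∷ xs) ys f = begin
  listSum ys (f x) + ∑[ x′ ∈ xs ] listSum ys (f x′)   ≡⟨ cong (_+_ (listSum ys (f x))) (∑ₗ-comm xs ys f) ⟩
  listSum ys (f x) + ∑[ y ∈ ys ] ∑[ x′ ∈ xs ] f x′ y  ≡⟨ sym (∑ₗ-distrib-+ ys (f x) _) ⟩
  ∑[ y ∈ ys ] (f x y + ∑[ x′ ∈ xs ] f x′ y)           ∎

∑ₗ-filter : ∀ {R : A → Set} (R? : Decidable R) (xs : List A) (f : A → ℕ) →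
  listSum (filter R? xs) f ≡ ∑[ x ∈ xs ] (χ (R? x) * f x)
∑ₗ-filter R? []       f = refl
∑ₗ-filter R? (x ∷ xs) f with R? x
... | yes _ = cong₂ _+_ (sym (+-identityʳ (f x))) (∑ₗ-filter R? xs f)
... | no _  = ∑ₗ-filter R? xs f

length-as-∑ₗ : ∀ (xs : List A) → length xs ≡ ∑[ x ∈ xs ] 1
length-as-∑ₗ []       = refl
length-as-∑ₗ (_ ∷ xs) = cong suc (length-as-∑ₗ xs)

length-filter-as-∑ₗ : ∀ {R : A → Set} (R? : Decidable R) (xs : List A) →
  length (filter R? xs) ≡ ∑[ x ∈ xs ] χ (R? x)
length-filter-as-∑ₗ R? xs = begin
  length (filter R? xs)              ≡⟨ length-as-∑ₗ (filter R? xs) ⟩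
  ∑[ x ∈ filter R? xs ] 1            ≡⟨ ∑ₗ-filter R? xs (λ _ → 1) ⟩
  ∑[ x ∈ xs ] (χ (R? x) * 1)         ≡⟨ ∑ₗ-cong xs (λ x → *-identityʳ (χ (R? x))) ⟩
  ∑[ x ∈ xs ] χ (R? x)               ∎

∑ₗ-tabulate : ∀ {n} (g : Fin n → A) (f : A → ℕ) → listSum (List.tabulate g) f ≡ ∑[ i < n ] f (g i)
∑ₗ-tabulate {n = zero}  g f = refl
∑ₗ-tabulate {n = suc n} g f = cong (_+_ (f (g zero))) (∑ₗ-tabulate (g ∘ suc) f)

∑ₗ-allFin : ∀ {n} (f : Fin n → ℕ) → listSum (allFin n) f ≡ ∑[ i < n ] f i
∑ₗ-allFin = ∑ₗ-tabulate id

listProduct : List A → (A → ℕ) → ℕ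
listProduct []       f = 1
listProduct (x ∷ xs) f = f x * listProduct xs f

syntax listProduct xs (λ x → e) = ∏[ x ∈ xs ] e

∑-const : ∀ n → ∑[ i < n ] 1 ≡ n
∑-const zero    = refl
∑-const (suc n) = cong suc (∑-const n)

∑-pick : ∀ {n} (p : Fin n) (f : Fin n → ℕ) → ∑[ i < n ] (χ (i Fin.≟ p) * f i) ≡ f p
∑-pick {suc n} zero    f = trans (cong₂ _+_ (*-identityˡ (f zero)) (sum-replicate-zero n)) (+-identityʳ (f zero))
∑-pick {suc n} (suc p) f = ∑-pick p (f ∘ suc)

lookup-injective : ∀ {xs : List A} → Unique xs → ∀ i j → List.lookup xs i ≡ List.lookup xs j → i ≡ j
lookup-injective (_ ∷ _)    zero    zero    _ = refl
lookup-injective (x∉ ∷ _)   zero    (suc j) e = contradiction e (All.lookup x∉ (∈-lookup j))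
lookup-injective (x∉ ∷ _)   (suc i) zero    e = contradiction (sym e) (All.lookup x∉ (∈-lookup i))
lookup-injective (_ ∷ uniq) (suc i) (suc j) e = cong suc (lookup-injective uniq i j e)

choices : ∀ {n} → (Fin n → List A) → List (Vec A n)
choices {n = zero}  _  = [] ∷ []
choices {n = suc n} ch = cartesianProductWith _∷_ (ch zero) (choices (ch ∘ suc))

∈-choices⁺ : ∀ {n} (ch : Fin n → List A) {v : Vec A n} → (∀ u → lookup v u ∈ ch u) → v ∈ choices ch
∈-choices⁺ {n = zero}  ch {[]}    _ = here refl
∈-choices⁺ {n = suc n} ch {a ∷ v} m = ∈-cartesianProductWith⁺ _∷_ (m zero) (∈-choices⁺ (ch ∘ suc) (m ∘ suc))

∈-choices⁻ : ∀ {n} (ch : Fin n → List A) {v : Vec A n} → v ∈ choices ch → ∀ u → lookup v u ∈ ch u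
∈-choices⁻ {n = suc n} ch m u with ∈-cartesianProductWith⁻ _∷_ (ch zero) (choices (ch ∘ suc)) m
∈-choices⁻ {n = suc n} ch m zero    | a , v , a∈ , v∈ , refl = a∈
∈-choices⁻ {n = suc n} ch m (suc u) | a , v , a∈ , v∈ , refl = ∈-choices⁻ (ch ∘ suc) v∈ u

choices-unique : ∀ {n} (ch : Fin n → List A) → (∀ u → Unique (ch u)) → Unique (choices ch)
choices-unique {n = zero}  ch _    = All.[] ∷ []
choices-unique {n = suc n} ch uniq =
  Unique.cartesianProductWith⁺ _∷_ Vec.∷-injective (uniq zero) (choices-unique (ch ∘ suc) (uniq ∘ suc))

choices-singleton : ∀ {n} (ch : Fin n → List A) (x : A) → (∀ u → ch u ≡ x ∷ []) →
  choices ch ≡ Vec.replicate n x ∷ []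
choices-singleton {n = zero}  ch x _ = refl
choices-singleton {n = suc n} ch x e
  rewrite e zero | choices-singleton (ch ∘ suc) x (e ∘ suc) = refl

∑-choices-insertAt : ∀ {n} (ch : Fin (suc n) → List A) (l : Fin (suc n)) (w : Vec A (suc n) → ℕ) →
  listSum (choices ch) w ≡ ∑[ a ∈ ch l ] ∑[ s ∈ choices (ch ∘ punchIn l) ] w (insertAt s l a)
∑-choices-insertAt ch zero w = ∑ₗ-cartesianProductWith _∷_ (ch zero) (choices (ch ∘ suc)) w
∑-choices-insertAt {n = suc n} ch (suc l) w = begin
  listSum (choices ch) w
    ≡⟨ ∑ₗ-cartesianProductWith _∷_ (ch zero) (choices (ch ∘ suc)) w ⟩
  ∑[ h ∈ ch zero ] ∑[ s ∈ choices (ch ∘ suc) ] w (h ∷ s)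
    ≡⟨ ∑ₗ-cong (ch zero) (λ h → ∑-choices-insertAt (ch ∘ suc) l (w ∘ (h ∷_))) ⟩
  ∑[ h ∈ ch zero ] ∑[ a ∈ ch (suc l) ] ∑[ s ∈ rest ] w (h ∷ insertAt s l a)
    ≡⟨ ∑ₗ-comm (ch zero) (ch (suc l)) _ ⟩
  ∑[ a ∈ ch (suc l) ] ∑[ h ∈ ch zero ] ∑[ s ∈ rest ] w (h ∷ insertAt s l a)
    ≡⟨ ∑ₗ-cong (ch (suc l)) (λ a → sym (∑ₗ-cartesianProductWith _∷_ (ch zero) rest (λ s → w (insertAt s (suc l) a)))) ⟩
  ∑[ a ∈ ch (suc l) ] ∑[ s ∈ choices (ch ∘ punchIn (suc l)) ] w (insertAt s (suc l) a) ∎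
  where
  rest = choices (ch ∘ suc ∘ punchIn l)

-- Walks and spanning trees grown leaf by leaf

module _ {n : ℕ} where

  ⁅_⁆ : Fin n → Fin n → Bool
  ⁅ r ⁆ u = does (u Fin.≟ r)

  _∪⁅_⁆ : (Fin n → Bool) → Fin n → Fin n → Bool
  (A ∪⁅ l ⁆) u = A u ∨ does (u Fin.≟ l)

  ∪⁅⁆⁻ : ∀ A l u → (A ∪⁅ l ⁆) u ≡ true → A u ≡ true ⊎ u ≡ l
  ∪⁅⁆⁻ A l u e with A u | u Fin.≟ l
  ... | true  | _     = inj₁ refl
  ... | false | yes u≡l = inj₂ u≡l

  ∪⁅⁆⁺ˡ : ∀ A l u → A u ≡ true → (A ∪⁅ l ⁆) u ≡ true
  ∪⁅⁆⁺ˡ A l u u∈ rewrite u∈ = refl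

  ∪⁅⁆⁺ʳ : ∀ A l → (A ∪⁅ l ⁆) l ≡ true
  ∪⁅⁆⁺ʳ A l rewrite dec-true (l Fin.≟ l) refl = Bool.∨-zeroʳ (A l)

  𝟙-∪⁅⁆ : ∀ A l → A l ≡ false → ∀ u → 𝟙 ((A ∪⁅ l ⁆) u) ≡ 𝟙 (A u) + χ (u Fin.≟ l)
  𝟙-∪⁅⁆ A l l∉ u with u Fin.≟ l
  ... | yes refl rewrite l∉ = refl
  ... | no _ = trans (cong 𝟙 (Bool.∨-identityʳ (A u))) (sym (+-identityʳ _))

module _ {n : ℕ} (G : SimpleGraph n) where
  open SimpleGraph G renaming (sym to Adj-sym)

  Linked-lookup : ∀ {x xs} → Linked Adj (x ∷ xs) → (i : Fin (length xs)) →
    Adj (List.lookup (x ∷ xs) (inject₁ i)) (List.lookup (x ∷ xs) (suc i))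
  Linked-lookup (a ∷ _)      zero    = a
  Linked-lookup (_ ∷ linked) (suc i) = Linked-lookup linked i

  data WalkIn (A : Fin n → Bool) : Fin n → Fin n → Set where
    nil  : ∀ {x} → A x ≡ true → WalkIn A x x
    cons : ∀ {x y z} → A x ≡ true → Adj x y → WalkIn A y z → WalkIn A x z

  module _ {A : Fin n → Bool} where

    later : ∀ {x z} → WalkIn A x z → List (Fin n)
    vertices : ∀ {x z} → WalkIn A x z → List (Fin n)
    later (nil _)      = []
    later (cons _ _ w) = vertices w
    vertices {x} w = x ∷ later w

    start-in : ∀ {x z} → WalkIn A x z → A x ≡ true
    start-in (nil x∈)      = x∈
    start-in (cons x∈ _ _) = x∈

    vertices-in : ∀ {x z} (w : WalkIn A x z) → All (λ v → A v ≡ true) (vertices w)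
    vertices-in (nil x∈)      = x∈ ∷ []
    vertices-in (cons x∈ _ w) = x∈ ∷ vertices-in w

    vertices-linked : ∀ {x z} (w : WalkIn A x z) → Linked Adj (vertices w)
    vertices-linked (nil _)                 = [-]
    vertices-linked (cons _ a w@(nil _))    = a ∷ [-]
    vertices-linked (cons _ a w@(cons _ _ _)) = a ∷ vertices-linked w

    lookup-last : ∀ {x z} (w : WalkIn A x z) → List.lookup (vertices w) (fromℕ (length (later w))) ≡ z
    lookup-last (nil _)      = refl
    lookup-last (cons _ _ w) = lookup-last w

    _++ʷ_ : ∀ {x y z} → WalkIn A x y → WalkIn A y z → WalkIn A x z
    nil _       ++ʷ w′ = w′
    cons x∈ a w ++ʷ w′ = cons x∈ a (w ++ʷ w′)

    reverseʷ : ∀ {x z} → WalkIn A x z → WalkIn A z x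
    reverseʷ (nil x∈)      = nil x∈
    reverseʷ (cons x∈ a w) = reverseʷ w ++ʷ cons (start-in w) (Adj-sym a) (nil x∈)

    SimpleWalkIn : Fin n → Fin n → Set
    SimpleWalkIn x z = Σ (WalkIn A x z) (Unique ∘ vertices)

    suffixFrom : ∀ {x y z} (w : WalkIn A y z) → x ∈ vertices w → Unique (vertices w) → SimpleWalkIn x z
    suffixFrom w            (here refl) uniq      = w , uniq
    suffixFrom (cons _ _ w) (there x∈)  (_ ∷ uniq) = suffixFrom w x∈ uniq

    eraseLoops : ∀ {x z} → WalkIn A x z → SimpleWalkIn x z
    eraseLoops (nil x∈) = nil x∈ , [] ∷ []
    eraseLoops {x} (cons x∈ a w) with eraseLoops w
    ... | w′ , uniq with DecMembership._∈?_ Fin._≟_ x (vertices w′)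
    ...   | yes x∈w′ = suffixFrom w′ x∈w′ uniq
    ...   | no  x∉w′ = cons x∈ a w′ , All.tabulate (λ v∈ x≡v → x∉w′ (subst (_∈ _) (sym x≡v) v∈)) ∷ uniq

  walkIn-mono : ∀ {A B : Fin n → Bool} → (∀ u → A u ≡ true → B u ≡ true) → ∀ {x z} → WalkIn A x z → WalkIn B x z
  walkIn-mono A⊆B (nil x∈)      = nil (A⊆B _ x∈)
  walkIn-mono A⊆B (cons x∈ a w) = cons (A⊆B _ x∈) a (walkIn-mono A⊆B w)

  cycle : ∀ {A l p q} → A l ≡ false → Adj l p → Adj l q → p ≢ q → SimpleWalkIn {A} p q → Cycle G
  cycle _ _ _ p≢q (nil _ , _) = ⊥-elim (p≢q refl)
  cycle {A} {l} {p} {q} l∉ alp alq _ (w@(cons _ _ w₁) , uniq) = record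
    { len      = length (later w₁)
    ; vert     = List.lookup (l ∷ vertices w)
    ; distinct = lookup-injective (All.map (λ v∈ l≡v → Bool.not-¬ l∉ (trans (cong A l≡v) v∈)) (vertices-in w) ∷ uniq)
    ; step     = Linked-lookup (alp ∷ vertices-linked w)
    ; close    = subst (λ v → Adj v l) (sym (lookup-last w₁)) (Adj-sym alq)
    }

  data Growth (r : Fin n) : (Fin n → Bool) → Set where
    root   : Growth r ⁅ r ⁆
    attach : ∀ {A} → Growth r A → (l p : Fin n) → A l ≡ false → A p ≡ true → Adj l p →
             (∀ q → A q ≡ true → Adj l q → q ≡ p) → Growth r (A ∪⁅ l ⁆)

  edges : ∀ {r A} → Growth r A → List (Fin n × Fin n)
  edges root                   = []
  edges (attach g l p _ _ _ _) = (l , p) ∷ edges g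

  root-in : ∀ {r A} → Growth r A → A r ≡ true
  root-in {r} root                   = dec-true (r Fin.≟ r) refl
  root-in (attach {A} g l _ _ _ _ _) = ∪⁅⁆⁺ˡ A l _ (root-in g)

  pathFromRoot : ∀ {r A} → Growth r A → ∀ a → A a ≡ true → WalkIn A r a
  pathFromRoot {r} root a a∈ with a Fin.≟ r | a∈
  ... | yes refl | _ = nil (root-in {r} root)
  pathFromRoot (attach {A} g l p _ p∈ alp _) a a∈ with ∪⁅⁆⁻ A l a a∈
  ... | inj₁ a∈A  = walkIn-mono (∪⁅⁆⁺ˡ A l) (pathFromRoot g a a∈A)
  ... | inj₂ refl = walkIn-mono (∪⁅⁆⁺ˡ A l) (pathFromRoot g p p∈)
                      ++ʷ cons (∪⁅⁆⁺ˡ A l p p∈) (Adj-sym alp) (nil (∪⁅⁆⁺ʳ A l))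

  attach-unique : Acyclic G → ∀ {r A} → Growth r A → ∀ {l p q} → A l ≡ false → A p ≡ true → A q ≡ true →
    Adj l p → Adj l q → q ≡ p
  attach-unique acyclic g {l} {p} {q} l∉ p∈ q∈ alp alq with q Fin.≟ p
  ... | yes q≡p = q≡p
  ... | no q≢p  = ⊥-elim (acyclic (cycle l∉ alp alq (q≢p ∘ sym)
                    (eraseLoops (reverseʷ (pathFromRoot g p p∈) ++ʷ pathFromRoot g q q∈))))

  exitEdge : ∀ {A : Fin n → Bool} {r w} → A r ≡ true → A w ≡ false → Walk G r w →
    ∃ λ p → ∃ λ l → A p ≡ true × A l ≡ false × Adj l p
  exitEdge r∈ w∉ nil = ⊥-elim (Bool.not-¬ w∉ r∈)
  exitEdge {A} {r} r∈ w∉ (cons {v = v} a walk) with A v in v∈?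
  ... | true  = exitEdge v∈? w∉ walk
  ... | false = r , v , r∈ , v∈? , Adj-sym a

  outside : (Fin n → Bool) → ℕ
  outside A = ∑[ u < n ] 𝟙 (not (A u))

  outside-∪⁅⁆ : ∀ A l → A l ≡ false → outside A ≡ suc (outside (A ∪⁅ l ⁆))
  outside-∪⁅⁆ A l l∉ = begin
    ∑[ u < n ] 𝟙 (not (A u))                                         ≡⟨ sum-cong-≗ split ⟩
    ∑[ u < n ] (χ (u Fin.≟ l) * 1 + 𝟙 (not ((A ∪⁅ l ⁆) u)))            ≡⟨ ∑-distrib-+ (λ u → χ (u Fin.≟ l) * 1) _ ⟩
    ∑[ u < n ] (χ (u Fin.≟ l) * 1) + outside (A ∪⁅ l ⁆)              ≡⟨ cong (_+ outside (A ∪⁅ l ⁆)) (∑-pick l (λ _ → 1)) ⟩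
    suc (outside (A ∪⁅ l ⁆))                                         ∎
    where
    split : ∀ u → 𝟙 (not (A u)) ≡ χ (u Fin.≟ l) * 1 + 𝟙 (not ((A ∪⁅ l ⁆) u))
    split u with u Fin.≟ l
    ... | yes refl rewrite l∉ = refl
    ... | no _ with A u
    ...   | true  = refl
    ...   | false = refl

  module _ (connected : Connected G) (acyclic : Acyclic G) (r : Fin n) where

    private
      grow : ∀ m {A} → Growth r A → outside A ≡ m → ∃ λ A′ → Growth r A′ × (∀ u → A′ u ≡ true)
      grow m {A} g out with Fin.all? (λ u → A u Bool.≟ true)
      ... | yes all = A , g , all
      ... | no ¬all with Fin.¬∀⟶∃¬ n _ (λ u → A u Bool.≟ true) ¬all
      ... | w , w∉ with exitEdge (root-in g) (Bool.¬-not w∉) (connected r w)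
      ... | p , l , p∈ , l∉ , alp with m | trans (sym out) (outside-∪⁅⁆ A l l∉)
      ... | suc m′ | out≡ = grow m′ (attach g l p l∉ p∈ alp (λ q q∈ alq → attach-unique acyclic g l∉ p∈ q∈ alp alq))
                                 (sym (suc-injective out≡))

    spanningGrowth : ∃ λ A → Growth r A × (∀ u → A u ≡ true)
    spanningGrowth = grow (outside ⁅ r ⁆) root refl

∑-expand-∪⁅⁆ : ∀ {n} (a : Fin n → ℕ) (l : Fin n) (K : Fin n → Fin n → ℕ) →
  ∑[ u < n ] ∑[ w < n ] ((a u + χ (u Fin.≟ l)) * (a w + χ (w Fin.≟ l)) * K u w)
    ≡ ∑[ u < n ] ∑[ w < n ] (a u * a w * K u w) + (∑[ u < n ] (a u * K u l) + (∑[ w < n ] (a w * K l w) + K l l))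
∑-expand-∪⁅⁆ {n} a l K = begin
  ∑[ u < n ] ∑[ w < n ] ((a u + δ u) * (a w + δ w) * K u w)
    ≡⟨ sum-cong-≗ (λ u → sum-cong-≗ (λ w → expand (a u) (δ u) (a w) (δ w) (K u w))) ⟩
  ∑[ u < n ] ∑[ w < n ] (a u * a w * K u w + (δ w * (a u * K u w) + δ u * (a w * K u w + δ w * K u w)))
    ≡⟨ sum-cong-≗ (λ u → ∑-distrib-+ (λ w → a u * a w * K u w) _) ⟩
  ∑[ u < n ] (∑[ w < n ] (a u * a w * K u w) + ∑[ w < n ] (δ w * (a u * K u w) + δ u * (a w * K u w + δ w * K u w)))
    ≡⟨ ∑-distrib-+ (λ u → ∑[ w < n ] (a u * a w * K u w)) _ ⟩
  ∑[ u < n ] ∑[ w < n ] (a u * a w * K u w) + ∑[ u < n ] ∑[ w < n ] (δ w * (a u * K u w) + δ u * (a w * K u w + δ w * K u w))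
    ≡⟨ cong (_+_ (∑[ u < n ] ∑[ w < n ] (a u * a w * K u w))) cross-terms ⟩
  ∑[ u < n ] ∑[ w < n ] (a u * a w * K u w) + (∑[ u < n ] (a u * K u l) + (∑[ w < n ] (a w * K l w) + K l l)) ∎
  where
  open ℕ-Solver
  δ : Fin _ → ℕ
  δ u = χ (u Fin.≟ l)
  expand : ∀ a d b e k → (a + d) * (b + e) * k ≡ a * b * k + (e * (a * k) + d * (b * k + e * k))
  expand = solve 5 (λ a d b e k → (a :+ d) :* (b :+ e) :* k := a :* b :* k :+ (e :* (a :* k) :+ d :* (b :* k :+ e :* k))) refl
  cross-terms : ∑[ u < n ] ∑[ w < n ] (δ w * (a u * K u w) + δ u * (a w * K u w + δ w * K u w))
                ≡ ∑[ u < n ] (a u * K u l) + (∑[ w < n ] (a w * K l w) + K l l)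
  cross-terms = begin
    ∑[ u < n ] ∑[ w < n ] (δ w * (a u * K u w) + δ u * (a w * K u w + δ w * K u w))
      ≡⟨ sum-cong-≗ (λ u → ∑-distrib-+ (λ w → δ w * (a u * K u w)) _) ⟩
    ∑[ u < n ] (∑[ w < n ] (δ w * (a u * K u w)) + ∑[ w < n ] (δ u * (a w * K u w + δ w * K u w)))
      ≡⟨ ∑-distrib-+ (λ u → ∑[ w < n ] (δ w * (a u * K u w))) _ ⟩
    ∑[ u < n ] ∑[ w < n ] (δ w * (a u * K u w)) + ∑[ u < n ] ∑[ w < n ] (δ u * (a w * K u w + δ w * K u w))
      ≡⟨ cong₂ _+_ (sum-cong-≗ (λ u → ∑-pick l (λ w → a u * K u w)))
                   (sum-cong-≗ (λ u → sym (*-distribˡ-sum (δ u) (λ w → a w * K u w + δ w * K u w)))) ⟩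
    ∑[ u < n ] (a u * K u l) + ∑[ u < n ] (δ u * ∑[ w < n ] (a w * K u w + δ w * K u w))
      ≡⟨ cong (_+_ (∑[ u < n ] (a u * K u l))) (∑-pick l (λ u → ∑[ w < n ] (a w * K u w + δ w * K u w))) ⟩
    ∑[ u < n ] (a u * K u l) + ∑[ w < n ] (a w * K l w + δ w * K l w)
      ≡⟨ cong (_+_ (∑[ u < n ] (a u * K u l)))
              (trans (∑-distrib-+ (λ w → a w * K l w) _) (cong (_+_ (∑[ w < n ] (a w * K l w))) (∑-pick l (K l)))) ⟩
    ∑[ u < n ] (a u * K u l) + (∑[ w < n ] (a w * K l w) + K l l) ∎

module _ {n : ℕ} (G : SimpleGraph n) where
  open SimpleGraph G renaming (sym to Adj-sym)

  ∑-growth-vertices : ∀ {r A} (g : Growth G r A) (f : Fin n → ℕ) →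
    ∑[ u < n ] (𝟙 (A u) * f u) ≡ f r + ∑[ e ∈ edges G g ] f (proj₁ e)
  ∑-growth-vertices {r} root f = trans (∑-pick r f) (sym (+-identityʳ (f r)))
  ∑-growth-vertices {r} (attach {A} g l p l∉ _ _ _) f = begin
    ∑[ u < n ] (𝟙 ((A ∪⁅ l ⁆) u) * f u)
      ≡⟨ sum-cong-≗ (λ u → trans (cong (_* f u) (𝟙-∪⁅⁆ A l l∉ u)) (*-distribʳ-+ (f u) (𝟙 (A u)) _)) ⟩
    ∑[ u < n ] (𝟙 (A u) * f u + χ (u Fin.≟ l) * f u)
      ≡⟨ ∑-distrib-+ (λ u → 𝟙 (A u) * f u) _ ⟩
    ∑[ u < n ] (𝟙 (A u) * f u) + ∑[ u < n ] (χ (u Fin.≟ l) * f u)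
      ≡⟨ cong₂ _+_ (∑-growth-vertices g f) (∑-pick l f) ⟩
    f r + E + f l
      ≡⟨ solve 3 (λ x e y → x :+ e :+ y := x :+ (y :+ e)) refl (f r) E (f l) ⟩
    f r + (f l + E) ∎
    where
    open ℕ-Solver
    E = ∑[ e ∈ edges G g ] f (proj₁ e)

  module _ {A : Fin n → Bool} {l p : Fin n} (p∈ : A p ≡ true) (alp : Adj l p)
           (unique : ∀ q → A q ≡ true → Adj l q → q ≡ p) where

    neighbour-in : ∀ u → 𝟙 (A u) * χ (adj? u l) ≡ χ (u Fin.≟ p)
    neighbour-in u with u Fin.≟ p
    ... | yes refl rewrite p∈ | χ-yes (adj? u l) (Adj-sym alp) = refl
    ... | no u≢p with A u in u∈?
    ...   | false = refl
    ...   | true  rewrite χ-no (adj? u l) (λ aul → u≢p (unique u u∈? (Adj-sym aul))) = refl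

    ∑-neighbour-in : (f : Fin n → ℕ) → ∑[ u < n ] (𝟙 (A u) * (χ (adj? u l) * f u)) ≡ f p
    ∑-neighbour-in f = begin
      ∑[ u < n ] (𝟙 (A u) * (χ (adj? u l) * f u))
        ≡⟨ sum-cong-≗ (λ u → trans (sym (*-assoc (𝟙 (A u)) _ (f u))) (cong (_* f u) (neighbour-in u))) ⟩
      ∑[ u < n ] (χ (u Fin.≟ p) * f u)
        ≡⟨ ∑-pick p f ⟩
      f p ∎

  χ-adj-sym : ∀ u w → χ (adj? u w) ≡ χ (adj? w u)
  χ-adj-sym u w = χ-cong (adj? u w) (adj? w u) Adj-sym Adj-sym

  χ-adj-irrefl : ∀ u → χ (adj? u u) ≡ 0
  χ-adj-irrefl u = χ-no (adj? u u) irrefl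

  ∑-growth-edges : ∀ {r A} (g : Growth G r A) (f : Fin n → Fin n → ℕ) →
    ∑[ u < n ] ∑[ w < n ] (𝟙 (A u) * 𝟙 (A w) * (χ (adj? u w) * f u w))
      ≡ ∑[ e ∈ edges G g ] (f (proj₁ e) (proj₂ e) + f (proj₂ e) (proj₁ e))
  ∑-growth-edges {r} root f = begin
    ∑[ u < n ] ∑[ w < n ] (δ u * δ w * K u w)    ≡⟨ sum-cong-≗ (λ u → sum-cong-≗ (λ w → swap (δ u) (δ w) (K u w))) ⟩
    ∑[ u < n ] ∑[ w < n ] (δ w * (δ u * K u w))  ≡⟨ sum-cong-≗ (λ u → ∑-pick r (λ w → δ u * K u w)) ⟩
    ∑[ u < n ] (δ u * K u r)                     ≡⟨ ∑-pick r (λ u → K u r) ⟩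
    χ (adj? r r) * f r r                         ≡⟨ cong (_* f r r) (χ-adj-irrefl r) ⟩
    0                                            ∎
    where
    open ℕ-Solver
    δ : Fin n → ℕ
    δ u = χ (u Fin.≟ r)
    K : Fin n → Fin n → ℕ
    K u w = χ (adj? u w) * f u w
    swap : ∀ a b k → a * b * k ≡ b * (a * k)
    swap = solve 3 (λ a b k → a :* b :* k := b :* (a :* k)) refl
  ∑-growth-edges (attach {A} g l p l∉ p∈ alp unique) f = begin
    ∑[ u < n ] ∑[ w < n ] (𝟙 ((A ∪⁅ l ⁆) u) * 𝟙 ((A ∪⁅ l ⁆) w) * K u w)
      ≡⟨ sum-cong-≗ (λ u → sum-cong-≗ (λ w → cong₂ (λ x y → x * y * K u w) (𝟙-∪⁅⁆ A l l∉ u) (𝟙-∪⁅⁆ A l l∉ w))) ⟩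
    ∑[ u < n ] ∑[ w < n ] ((a u + χ (u Fin.≟ l)) * (a w + χ (w Fin.≟ l)) * K u w)
      ≡⟨ ∑-expand-∪⁅⁆ a l K ⟩
    ∑[ u < n ] ∑[ w < n ] (a u * a w * K u w) + (∑[ u < n ] (a u * K u l) + (∑[ w < n ] (a w * K l w) + K l l))
      ≡⟨ cong₂ _+_ (∑-growth-edges g f) (cong₂ _+_ (∑-neighbour-in p∈ alp unique (λ u → f u l))
                                        (cong₂ _+_ (trans (sum-cong-≗ (λ w → cong (λ x → a w * (x * f l w)) (χ-adj-sym l w)))
                                                          (∑-neighbour-in p∈ alp unique (f l)))
                                                   (cong (_* f l l) (χ-adj-irrefl l)))) ⟩
    E + (f p l + (f l p + 0))
      ≡⟨ solve 3 (λ e x y → e :+ (x :+ (y :+ con 0)) := y :+ x :+ e) refl E (f p l) (f l p) ⟩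
    f l p + f p l + E ∎
    where
    open ℕ-Solver
    a : Fin n → ℕ
    a u = 𝟙 (A u)
    K : Fin n → Fin n → ℕ
    K u w = χ (adj? u w) * f u w
    E = ∑[ e ∈ edges G g ] (f (proj₁ e) (proj₂ e) + f (proj₂ e) (proj₁ e))

-- Counting compatible labellings of a tree

choices-cong : ∀ {n} {ch ch′ : Fin n → List A} → (∀ u → ch u ≡ ch′ u) → choices ch ≡ choices ch′
choices-cong {n = zero}  _ = refl
choices-cong {n = suc n} e = cong₂ (List.cartesianProductWith _) (e zero) (choices-cong (e ∘ suc))

lookup-insertAt-≢ : ∀ {n} (s : Vec A n) (l : Fin (suc n)) {a b : A} {u} → u ≢ l →
  lookup (insertAt s l a) u ≡ lookup (insertAt s l b) u
lookup-insertAt-≢ s l {a} {b} u≢l = begin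
  lookup (insertAt s l a) _                           ≡⟨ cong (lookup (insertAt s l a)) (sym (Fin.punchIn-punchOut l≢u)) ⟩
  lookup (insertAt s l a) (punchIn l (punchOut l≢u))  ≡⟨ Vec.insertAt-punchIn s l a _ ⟩
  lookup s (punchOut l≢u)                             ≡⟨ sym (Vec.insertAt-punchIn s l b _) ⟩
  lookup (insertAt s l b) (punchIn l (punchOut l≢u))  ≡⟨ cong (lookup (insertAt s l b)) (Fin.punchIn-punchOut l≢u) ⟩
  lookup (insertAt s l b) _                           ∎
  where
  l≢u = u≢l ∘ sym

module _ {n : ℕ} (G : SimpleGraph n) {St : Set} (R : St → St → Set) where
  open SimpleGraph G

  Compatible : Vec St n → Set
  Compatible s = ∀ u v → Adj u v → R (lookup s u) (lookup s v)

  module _ (R? : ∀ a b → Dec (R a b)) where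

    compatible? : ∀ s → Dec (Compatible s)
    compatible? s = Fin.all? λ u → Fin.all? λ v → adj? u v →-dec R? (lookup s u) (lookup s v)

    compatibleLabellings : (Fin n → List St) → List (Vec St n)
    compatibleLabellings ch = filter compatible? (choices ch)

module _ {n : ℕ} (G : SimpleGraph (suc n)) {St : Set}
         (R : St → St → Set) (R? : ∀ a b → Dec (R a b)) (R-sym : ∀ {a b} → R a b → R b a) where
  open SimpleGraph G renaming (sym to Adj-sym)

  module _ (ch : Fin (suc n) → List St) (∗ : St) where

    -- A labelling of the part A of the tree is a full vector carrying the dummy state ∗ outside A.
    restrict : (Fin (suc n) → Bool) → Fin (suc n) → List St
    restrict A u = if A u then ch u else ∗ ∷ []

    CompatibleOn : (Fin (suc n) → Bool) → Vec St (suc n) → Set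
    CompatibleOn A s = ∀ u v → A u ≡ true → A v ≡ true → Adj u v → R (lookup s u) (lookup s v)

    compatibleOn? : ∀ A s → Dec (CompatibleOn A s)
    compatibleOn? A s = Fin.all? λ u → Fin.all? λ v →
      (A u Bool.≟ true) →-dec ((A v Bool.≟ true) →-dec (adj? u v →-dec R? (lookup s u) (lookup s v)))

    count : (Fin (suc n) → Bool) → ℕ
    count A = ∑[ s ∈ choices (restrict A) ] χ (compatibleOn? A s)

    count-root : ∀ r → count ⁅ r ⁆ ≡ length (ch r)
    count-root r = begin
      ∑[ s ∈ choices (restrict ⁅ r ⁆) ] χ (compatibleOn? ⁅ r ⁆ s)
        ≡⟨ ∑ₗ-cong (choices (restrict ⁅ r ⁆)) (λ s → χ-yes (compatibleOn? ⁅ r ⁆ s) (only-root s)) ⟩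
      ∑[ s ∈ choices (restrict ⁅ r ⁆) ] 1
        ≡⟨ ∑-choices-insertAt (restrict ⁅ r ⁆) r (λ _ → 1) ⟩
      ∑[ a ∈ restrict ⁅ r ⁆ r ] ∑[ s ∈ choices (restrict ⁅ r ⁆ ∘ punchIn r) ] 1
        ≡⟨ cong₂ listSum r-choices (cong (λ ss → λ _ → listSum ss (λ _ → 1)) others) ⟩
      ∑[ a ∈ ch r ] 1
        ≡⟨ sym (length-as-∑ₗ (ch r)) ⟩
      length (ch r) ∎
      where
      only-root : ∀ s → CompatibleOn ⁅ r ⁆ s
      only-root s u v u∈ v∈ auv with u Fin.≟ r | v Fin.≟ r | u∈ | v∈
      ... | yes refl | yes refl | _ | _ = contradiction auv irrefl
      r-choices : restrict ⁅ r ⁆ r ≡ ch r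
      r-choices rewrite dec-true (r Fin.≟ r) refl = refl
      others : choices (restrict ⁅ r ⁆ ∘ punchIn r) ≡ Vec.replicate n ∗ ∷ []
      others = choices-singleton _ ∗ (λ u → cong (λ b → if b then ch (punchIn r u) else ∗ ∷ [])
                                                 (dec-false (punchIn r u Fin.≟ r) (Fin.punchInᵢ≢i r u)))

    module _ (size : Fin (suc n) → Fin (suc n) → ℕ)
             (fibre : ∀ {l p} → Adj l p → ∀ {t} → t ∈ ch p → ∑[ a ∈ ch l ] χ (R? a t) ≡ size l p) where

      module _ {A : Fin (suc n) → Bool} {l p : Fin (suc n)} (l∉ : A l ≡ false) (p∈ : A p ≡ true)
               (alp : Adj l p) (unique : ∀ q → A q ≡ true → Adj l q → q ≡ p) where

        private
          rest : Fin n → List St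
          rest = restrict A ∘ punchIn l

          label : Vec St n → St → Vec St (suc n)
          label s a = insertAt s l a

          parent : Vec St n → St
          parent s = lookup (label s ∗) p

          in-A⇒≢l : ∀ {u} → A u ≡ true → u ≢ l
          in-A⇒≢l u∈ u≡l = Bool.not-¬ l∉ (trans (cong A (sym u≡l)) u∈)

          parent-label : ∀ s a → lookup (label s a) p ≡ parent s
          parent-label s a = lookup-insertAt-≢ s l (in-A⇒≢l p∈)

          compatible-split : ∀ s a → CompatibleOn (A ∪⁅ l ⁆) (label s a) → CompatibleOn A (label s ∗) × R a (parent s)
          compatible-split s a c =
              (λ u v u∈ v∈ auv → subst₂ R (lookup-insertAt-≢ s l (in-A⇒≢l u∈)) (lookup-insertAt-≢ s l (in-A⇒≢l v∈))
                                     (c u v (∪⁅⁆⁺ˡ A l u u∈) (∪⁅⁆⁺ˡ A l v v∈) auv))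
            , subst₂ R (Vec.insertAt-lookup s l a) (parent-label s a) (c l p (∪⁅⁆⁺ʳ A l) (∪⁅⁆⁺ˡ A l p p∈) alp)

          compatible-join : ∀ s a → CompatibleOn A (label s ∗) × R a (parent s) → CompatibleOn (A ∪⁅ l ⁆) (label s a)
          compatible-join s a (c , r) u v u∈ v∈ auv with ∪⁅⁆⁻ A l u u∈ | ∪⁅⁆⁻ A l v v∈
          ... | inj₁ u∈A | inj₁ v∈A = subst₂ R (sym (lookup-insertAt-≢ s l (in-A⇒≢l u∈A)))
                                               (sym (lookup-insertAt-≢ s l (in-A⇒≢l v∈A))) (c u v u∈A v∈A auv)
          ... | inj₂ refl | inj₂ refl = contradiction auv irrefl
          ... | inj₂ refl | inj₁ v∈A with refl ← unique v v∈A auv =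
            subst₂ R (sym (Vec.insertAt-lookup s l a)) (sym (parent-label s a)) r
          ... | inj₁ u∈A | inj₂ refl with refl ← unique u u∈A (Adj-sym auv) =
            subst₂ R (sym (parent-label s a)) (sym (Vec.insertAt-lookup s l a)) (R-sym r)

          χ-compatible-∪⁅⁆ : ∀ s a → χ (compatibleOn? (A ∪⁅ l ⁆) (label s a))
                                   ≡ χ (compatibleOn? A (label s ∗)) * χ (R? a (parent s))
          χ-compatible-∪⁅⁆ s a = trans (χ-cong (compatibleOn? (A ∪⁅ l ⁆) (label s a)) (compatibleOn? A (label s ∗) ×-dec R? a (parent s))
                                               (compatible-split s a) (compatible-join s a))
                                       (χ-× (compatibleOn? A (label s ∗)) (R? a (parent s)))

          parent-choice : ∀ {s} → s ∈ choices rest → parent s ∈ ch p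
          parent-choice {s} s∈ = subst₂ _∈_ label-p rest-p (∈-choices⁻ rest s∈ (punchOut l≢p))
            where
            l≢p = in-A⇒≢l p∈ ∘ sym
            label-p : lookup s (punchOut l≢p) ≡ parent s
            label-p = trans (sym (Vec.insertAt-punchIn s l ∗ _)) (cong (lookup (label s ∗)) (Fin.punchIn-punchOut l≢p))
            rest-p : rest (punchOut l≢p) ≡ ch p
            rest-p = trans (cong (restrict A) (Fin.punchIn-punchOut l≢p)) (cong (λ b → if b then ch p else ∗ ∷ []) p∈)

          count-as-rest : count A ≡ ∑[ s ∈ choices rest ] χ (compatibleOn? A (label s ∗))
          count-as-rest = begin
            count A                 ≡⟨ ∑-choices-insertAt (restrict A) l _ ⟩
            ∑[ a ∈ restrict A l ] ∑[ s ∈ choices rest ] χ (compatibleOn? A (label s a))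
                                    ≡⟨ cong (λ as → listSum as (λ a → ∑[ s ∈ choices rest ] χ (compatibleOn? A (label s a)))) l-choices ⟩
            ∑[ s ∈ choices rest ] χ (compatibleOn? A (label s ∗)) + 0
                                    ≡⟨ +-identityʳ _ ⟩
            ∑[ s ∈ choices rest ] χ (compatibleOn? A (label s ∗)) ∎
            where
            l-choices : restrict A l ≡ ∗ ∷ []
            l-choices rewrite l∉ = refl

        count-attach : count (A ∪⁅ l ⁆) ≡ size l p * count A
        count-attach = begin
          count (A ∪⁅ l ⁆)
            ≡⟨ ∑-choices-insertAt (restrict (A ∪⁅ l ⁆)) l _ ⟩
          ∑[ a ∈ restrict (A ∪⁅ l ⁆) l ] ∑[ s ∈ choices (restrict (A ∪⁅ l ⁆) ∘ punchIn l) ]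
            χ (compatibleOn? (A ∪⁅ l ⁆) (label s a))
            ≡⟨ cong₂ (λ as ss → ∑[ a ∈ as ] ∑[ s ∈ ss ] χ (compatibleOn? (A ∪⁅ l ⁆) (label s a)))
                     l-choices (choices-cong rest-choices) ⟩
          ∑[ a ∈ ch l ] ∑[ s ∈ choices rest ] χ (compatibleOn? (A ∪⁅ l ⁆) (label s a))
            ≡⟨ ∑ₗ-cong (ch l) (λ a → ∑ₗ-cong (choices rest) (λ s → χ-compatible-∪⁅⁆ s a)) ⟩
          ∑[ a ∈ ch l ] ∑[ s ∈ choices rest ] (X s * χ (R? a (parent s)))
            ≡⟨ ∑ₗ-comm (ch l) (choices rest) _ ⟩
          ∑[ s ∈ choices rest ] ∑[ a ∈ ch l ] (X s * χ (R? a (parent s)))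
            ≡⟨ ∑ₗ-cong (choices rest) (λ s → sym (*-distribˡ-∑ₗ (X s) (ch l) _)) ⟩
          ∑[ s ∈ choices rest ] (X s * ∑[ a ∈ ch l ] χ (R? a (parent s)))
            ≡⟨ ∑ₗ-cong-∈ (choices rest) (λ s∈ → cong (X _ *_) (fibre alp (parent-choice s∈))) ⟩
          ∑[ s ∈ choices rest ] (X s * size l p)
            ≡⟨ ∑ₗ-cong (choices rest) (λ s → *-comm (X s) (size l p)) ⟩
          ∑[ s ∈ choices rest ] (size l p * X s)
            ≡⟨ sym (*-distribˡ-∑ₗ (size l p) (choices rest) X) ⟩
          size l p * ∑[ s ∈ choices rest ] X s
            ≡⟨ cong (size l p *_) (sym count-as-rest) ⟩
          size l p * count A ∎
          where
          X : Vec St n → ℕ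
          X s = χ (compatibleOn? A (label s ∗))
          l-choices : restrict (A ∪⁅ l ⁆) l ≡ ch l
          l-choices rewrite ∪⁅⁆⁺ʳ A l = refl
          rest-choices : ∀ u → restrict (A ∪⁅ l ⁆) (punchIn l u) ≡ rest u
          rest-choices u rewrite dec-false (punchIn l u Fin.≟ l) (Fin.punchInᵢ≢i l u)
                               | Bool.∨-identityʳ (A (punchIn l u)) = refl

      count-growth : ∀ {r A} (g : Growth G r A) → count A ≡ length (ch r) * ∏[ e ∈ edges G g ] size (proj₁ e) (proj₂ e)
      count-growth {r} root = trans (count-root r) (sym (*-identityʳ _))
      count-growth {r} (attach {A} g l p l∉ p∈ alp unique) = begin
        count (A ∪⁅ l ⁆)                       ≡⟨ count-attach l∉ p∈ alp unique ⟩
        size l p * count A                         ≡⟨ cong (size l p *_) (count-growth g) ⟩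
        size l p * (length (ch r) * Π)             ≡⟨ *-Semigroup.x∙yz≈y∙xz (size l p) (length (ch r)) Π ⟩
        length (ch r) * (size l p * Π)             ∎
        where
        Π = ∏[ e ∈ edges G g ] size (proj₁ e) (proj₂ e)

      length-compatibleLabellings : ∀ {r A} (g : Growth G r A) → (∀ u → A u ≡ true) →
        length (compatibleLabellings G R R? ch) ≡ length (ch r) * ∏[ e ∈ edges G g ] size (proj₁ e) (proj₂ e)
      length-compatibleLabellings {r} {A} g all = begin
        length (filter (compatible? G R R?) (choices ch))
          ≡⟨ length-filter-as-∑ₗ (compatible? G R R?) (choices ch) ⟩
        ∑[ s ∈ choices ch ] χ (compatible? G R R? s)
          ≡⟨ cong (λ ss → listSum ss (χ ∘ compatible? G R R?)) (choices-cong (λ u → sym (restrict-all u))) ⟩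
        ∑[ s ∈ choices (restrict A) ] χ (compatible? G R R? s)
          ≡⟨ ∑ₗ-cong (choices (restrict A)) (λ s → χ-cong (compatible? G R R? s) (compatibleOn? A s)
                                                    (λ c u v _ _ → c u v) (λ c u v → c u v (all u) (all v))) ⟩
        count A
          ≡⟨ count-growth g ⟩
        length (ch r) * ∏[ e ∈ edges G g ] size (proj₁ e) (proj₂ e) ∎
        where
        restrict-all : ∀ u → restrict A u ≡ ch u
        restrict-all u rewrite all u = refl

C2-suc : ∀ m → suc m C 2 ≡ m + (m C 2)
C2-suc m = trans (sym (nCk+nC[k+1]≡[n+1]C[k+1] m 1)) (cong (_+ (m C 2)) (nC1≡n m))

∑-increasing-pairs : ∀ {m} (g : Fin m → ℕ) → (∀ a → g a ≤ 1) →
  ∑[ a < m ] ∑[ b < m ] (χ (a Fin.<? b) * (g a * g b)) ≡ (∑[ a < m ] g a) C 2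
∑-increasing-pairs {zero}  g g≤1 = refl
∑-increasing-pairs {suc m} g g≤1 = begin
  0 + ∑[ b < m ] (g zero * g (suc b) + 0) + ∑[ a < m ] ∑[ b < m ] (χ (a Fin.<? b) * (g (suc a) * g (suc b)))
    ≡⟨ cong₂ _+_ (trans (sum-cong-≗ (λ b → +-identityʳ (g zero * g (suc b)))) (sym (*-distribˡ-sum (g zero) (g ∘ suc))))
                 (∑-increasing-pairs (g ∘ suc) (g≤1 ∘ suc)) ⟩
  g zero * G + (G C 2)
    ≡⟨ first-step (g zero) (g≤1 zero) ⟩
  (g zero + G) C 2 ∎
  where
  G = ∑[ a < m ] g (suc a)
  first-step : ∀ x → x ≤ 1 → x * G + (G C 2) ≡ (x + G) C 2
  first-step 0 _             = refl
  first-step 1 _             = trans (cong (_+ (G C 2)) (+-identityʳ G)) (sym (C2-suc G))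
  first-step (suc (suc _)) (s≤s ())

m+n≡k⇒m≡k∸n : ∀ {m n k} → m + n ≡ k → m ≡ k ∸ n
m+n≡k⇒m≡k∸n {m} {n} eq = trans (sym (m+n∸n≡m m n)) (cong (_∸ n) eq)

-- A vertex of S carries a pair of colours a < b, any other vertex a single colour a, stored as (a , a).
module _ (k : ℕ) where

  State : Set
  State = Fin k × Fin k

  increasingPairs : List State
  increasingPairs = filter (λ t → proj₁ t Fin.<? proj₂ t) (cartesianProduct (allFin k) (allFin k))

  states : Bool → List State
  states false = map (λ a → a , a) (allFin k)
  states true  = increasingPairs

  Disjoint : State → State → Set
  Disjoint (a , b) (c , d) = a ≢ c × a ≢ d × b ≢ c × b ≢ d

  disjoint? : ∀ s t → Dec (Disjoint s t)
  disjoint? (a , b) (c , d) = ¬? (a Fin.≟ c) ×-dec ¬? (a Fin.≟ d) ×-dec ¬? (b Fin.≟ c) ×-dec ¬? (b Fin.≟ d)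

  Disjoint-sym : ∀ {s t} → Disjoint s t → Disjoint t s
  Disjoint-sym (a≢c , a≢d , b≢c , b≢d) = a≢c ∘ sym , b≢c ∘ sym , a≢d ∘ sym , b≢d ∘ sym

  ∑-increasingPairs : ∀ f → ∑[ t ∈ increasingPairs ] f t ≡ ∑[ x < k ] ∑[ y < k ] (χ (x Fin.<? y) * f (x , y))
  ∑-increasingPairs f = begin
    ∑[ t ∈ increasingPairs ] f t
      ≡⟨ ∑ₗ-filter (λ t → proj₁ t Fin.<? proj₂ t) (cartesianProduct (allFin k) (allFin k)) f ⟩
    ∑[ t ∈ cartesianProduct (allFin k) (allFin k) ] (χ (proj₁ t Fin.<? proj₂ t) * f t)
      ≡⟨ ∑ₗ-cartesianProductWith _,_ (allFin k) (allFin k) (λ t → χ (proj₁ t Fin.<? proj₂ t) * f t) ⟩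
    ∑[ x ∈ allFin k ] ∑[ y ∈ allFin k ] (χ (x Fin.<? y) * f (x , y))
      ≡⟨ ∑ₗ-allFin (λ x → ∑[ y ∈ allFin k ] (χ (x Fin.<? y) * f (x , y))) ⟩
    ∑[ x < k ] ∑[ y ∈ allFin k ] (χ (x Fin.<? y) * f (x , y))
      ≡⟨ sum-cong-≗ (λ x → ∑ₗ-allFin (λ y → χ (x Fin.<? y) * f (x , y))) ⟩
    ∑[ x < k ] ∑[ y < k ] (χ (x Fin.<? y) * f (x , y)) ∎

  length-increasingPairs : length increasingPairs ≡ k C 2
  length-increasingPairs = begin
    length increasingPairs                        ≡⟨ length-as-∑ₗ increasingPairs ⟩
    ∑[ t ∈ increasingPairs ] 1                    ≡⟨ ∑-increasingPairs (λ _ → 1) ⟩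
    ∑[ x < k ] ∑[ y < k ] (χ (x Fin.<? y) * 1)    ≡⟨ ∑-increasing-pairs {k} (λ _ → 1) (λ _ → ≤-refl) ⟩
    (∑[ x < k ] 1) C 2                            ≡⟨ cong (_C 2) (∑-const k) ⟩
    k C 2                                         ∎

module _ {k : ℕ} where

  states-unique : ∀ b → Unique (states k b)
  states-unique false = Unique.map⁺ (cong proj₁) (Unique.allFin⁺ k)
  states-unique true  = Unique.filter⁺ _ (Unique.cartesianProduct⁺ (Unique.allFin⁺ k) (Unique.allFin⁺ k))

  ∈-states-false⁻ : ∀ {t} → t ∈ states k false → proj₁ t ≡ proj₂ t
  ∈-states-false⁻ t∈ with ∈-map⁻ (λ a → a , a) t∈
  ... | _ , _ , refl = refl

  ∈-states-true⁻ : ∀ {t} → t ∈ states k true → proj₁ t Fin.< proj₂ t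
  ∈-states-true⁻ t∈ = proj₂ (∈-filter⁻ (λ t → proj₁ t Fin.<? proj₂ t) {xs = cartesianProduct (allFin k) (allFin k)} t∈)

  ∈-states-false⁺ : ∀ a → (a , a) ∈ states k false
  ∈-states-false⁺ a = ∈-map⁺ (λ a → a , a) (∈-allFin a)

  ∈-states-true⁺ : ∀ {a b} → a Fin.< b → (a , b) ∈ states k true
  ∈-states-true⁺ {a} {b} a<b =
    ∈-filter⁺ (λ t → proj₁ t Fin.<? proj₂ t) (∈-cartesianProductWith⁺ _,_ (∈-allFin a) (∈-allFin b)) a<b

module _ (k : ℕ) where

  avoids : State k → Fin k → ℕ
  avoids (c , d) x = χ (¬? (x Fin.≟ c) ×-dec ¬? (x Fin.≟ d))

  avoids≤1 : ∀ t x → avoids t x ≤ 1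
  avoids≤1 t x with does (¬? (x Fin.≟ proj₁ t) ×-dec ¬? (x Fin.≟ proj₂ t))
  ... | true  = ≤-refl
  ... | false = z≤n

  ∑-avoids-diagonal : ∀ c → ∑[ x < k ] avoids (c , c) x ≡ k ∸ 1
  ∑-avoids-diagonal c = m+n≡k⇒m≡k∸n (begin
    ∑[ x < k ] avoids (c , c) x + 1                                ≡⟨ cong (_+_ (∑[ x < k ] avoids (c , c) x)) (sym (∑-pick c (λ _ → 1))) ⟩
    ∑[ x < k ] avoids (c , c) x + ∑[ x < k ] (χ (x Fin.≟ c) * 1)   ≡⟨ sym (∑-distrib-+ (avoids (c , c)) _) ⟩
    ∑[ x < k ] (avoids (c , c) x + χ (x Fin.≟ c) * 1)              ≡⟨ sum-cong-≗ split ⟩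
    ∑[ x < k ] 1                                                   ≡⟨ ∑-const k ⟩
    k                                                              ∎)
    where
    split : ∀ x → avoids (c , c) x + χ (x Fin.≟ c) * 1 ≡ 1
    split x with x Fin.≟ c
    ... | yes _ = refl
    ... | no _  = refl

  ∑-avoids-pair : ∀ {c d} → c ≢ d → ∑[ x < k ] avoids (c , d) x ≡ k ∸ 2
  ∑-avoids-pair {c} {d} c≢d = m+n≡k⇒m≡k∸n (begin
    ∑[ x < k ] avoids (c , d) x + 2
      ≡⟨ cong (_+_ (∑[ x < k ] avoids (c , d) x)) (sym (cong₂ _+_ (∑-pick c (λ _ → 1)) (∑-pick d (λ _ → 1)))) ⟩
    ∑[ x < k ] avoids (c , d) x + (∑[ x < k ] (χ (x Fin.≟ c) * 1) + ∑[ x < k ] (χ (x Fin.≟ d) * 1))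
      ≡⟨ cong (_+_ (∑[ x < k ] avoids (c , d) x)) (sym (∑-distrib-+ (λ x → χ (x Fin.≟ c) * 1) _)) ⟩
    ∑[ x < k ] avoids (c , d) x + ∑[ x < k ] (χ (x Fin.≟ c) * 1 + χ (x Fin.≟ d) * 1)
      ≡⟨ sym (∑-distrib-+ (avoids (c , d)) _) ⟩
    ∑[ x < k ] (avoids (c , d) x + (χ (x Fin.≟ c) * 1 + χ (x Fin.≟ d) * 1))
      ≡⟨ sum-cong-≗ split ⟩
    ∑[ x < k ] 1
      ≡⟨ ∑-const k ⟩
    k ∎)
    where
    split : ∀ x → avoids (c , d) x + (χ (x Fin.≟ c) * 1 + χ (x Fin.≟ d) * 1) ≡ 1
    split x with x Fin.≟ c | x Fin.≟ d
    ... | yes refl | yes refl = contradiction refl c≢d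
    ... | yes _    | no _     = refl
    ... | no _     | yes _    = refl
    ... | no _     | no _     = refl

  avoidCount : Bool → ℕ
  avoidCount false = k ∸ 1
  avoidCount true  = k ∸ 2

  ∑-avoids : ∀ {b t} → t ∈ states k b → ∑[ x < k ] avoids t x ≡ avoidCount b
  ∑-avoids {false} t∈ with ∈-map⁻ (λ a → a , a) t∈
  ... | c , _ , refl = ∑-avoids-diagonal c
  ∑-avoids {true}  t∈ = ∑-avoids-pair (Fin.<⇒≢ (∈-states-true⁻ t∈))

  fibreSize : Bool → Bool → ℕ
  fibreSize false b′ = avoidCount b′
  fibreSize true  b′ = avoidCount b′ C 2

  ∑-disjoint : ∀ b {b′ t} → t ∈ states k b′ → ∑[ s ∈ states k b ] χ (disjoint? k s t) ≡ fibreSize b b′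
  ∑-disjoint false {b′} {t} t∈ = begin
    ∑[ s ∈ map (λ a → a , a) (allFin k) ] χ (disjoint? k s t)  ≡⟨ ∑ₗ-map (λ a → a , a) (allFin k) (λ s → χ (disjoint? k s t)) ⟩
    ∑[ x ∈ allFin k ] χ (disjoint? k (x , x) t)               ≡⟨ ∑ₗ-allFin (λ x → χ (disjoint? k (x , x) t)) ⟩
    ∑[ x < k ] χ (disjoint? k (x , x) t)                      ≡⟨ sum-cong-≗ (χ-disjoint-diagonal t) ⟩
    ∑[ x < k ] avoids t x                                     ≡⟨ ∑-avoids {b′} t∈ ⟩
    avoidCount b′                                             ∎
    where
    χ-disjoint-diagonal : ∀ t x → χ (disjoint? k (x , x) t) ≡ avoids t x
    χ-disjoint-diagonal (c , d) x = χ-cong (disjoint? k (x , x) (c , d)) (¬? (x Fin.≟ c) ×-dec ¬? (x Fin.≟ d))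
      (λ (x≢c , x≢d , _ , _) → x≢c , x≢d) (λ (x≢c , x≢d) → x≢c , x≢d , x≢c , x≢d)
  ∑-disjoint true {b′} {t} t∈ = begin
    ∑[ s ∈ increasingPairs k ] χ (disjoint? k s t)
      ≡⟨ ∑-increasingPairs k (λ s → χ (disjoint? k s t)) ⟩
    ∑[ x < k ] ∑[ y < k ] (χ (x Fin.<? y) * χ (disjoint? k (x , y) t))
      ≡⟨ sum-cong-≗ (λ x → sum-cong-≗ (λ y → cong (χ (x Fin.<? y) *_) (χ-disjoint-pair t x y))) ⟩
    ∑[ x < k ] ∑[ y < k ] (χ (x Fin.<? y) * (avoids t x * avoids t y))
      ≡⟨ ∑-increasing-pairs (avoids t) (avoids≤1 t) ⟩
    (∑[ x < k ] avoids t x) C 2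
      ≡⟨ cong (_C 2) (∑-avoids {b′} t∈) ⟩
    avoidCount b′ C 2 ∎
    where
    χ-disjoint-pair : ∀ t x y → χ (disjoint? k (x , y) t) ≡ avoids t x * avoids t y
    χ-disjoint-pair (c , d) x y =
      trans (χ-cong (disjoint? k (x , y) (c , d)) ((¬? (x Fin.≟ c) ×-dec ¬? (x Fin.≟ d)) ×-dec (¬? (y Fin.≟ c) ×-dec ¬? (y Fin.≟ d)))
                    (λ (x≢c , x≢d , y≢c , y≢d) → (x≢c , x≢d) , (y≢c , y≢d))
                    (λ ((x≢c , x≢d) , (y≢c , y≢d)) → x≢c , x≢d , y≢c , y≢d))
            (χ-× (¬? (x Fin.≟ c) ×-dec ¬? (x Fin.≟ d)) (¬? (y Fin.≟ c) ×-dec ¬? (y Fin.≟ d)))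

C2-double : ∀ m → 2 * (m C 2) ≡ m * (m ∸ 1)
C2-double zero    = refl
C2-double (suc m) = begin
  2 * (suc m C 2)             ≡⟨ cong (2 *_) (C2-suc m) ⟩
  2 * (m + (m C 2))           ≡⟨ *-distribˡ-+ 2 m (m C 2) ⟩
  2 * m + 2 * (m C 2)     ≡⟨ cong (_+_ (2 * m)) (C2-double m) ⟩
  2 * m + m * (m ∸ 1)     ≡⟨ last-step m ⟩
  suc m * m                   ∎
  where
  last-step : ∀ m → 2 * m + m * (m ∸ 1) ≡ suc m * m
  last-step zero    = refl
  last-step (suc m) = solve 1 (λ m → con 2 :* (con 1 :+ m) :+ (con 1 :+ m) :* m := (con 2 :+ m) :* (con 1 :+ m)) refl m
    where open ℕ-Solver

module MonomialNotation (k : ℕ) where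
  X Y Z : ℤ
  X = + k ℤ.- + 1
  Y = + k ℤ.- + 2
  Z = + k ℤ.- + 3

module _ (k : ℕ) where
  open MonomialNotation k

  monomial : ℕ → ℕ → ℕ → ℤ
  monomial a b c = X ℤ.^ a ℤ.* Y ℤ.^ b ℤ.* Z ℤ.^ c

  monomial-+ : ∀ a b c a′ b′ c′ → monomial (a + a′) (b + b′) (c + c′) ≡ monomial a b c ℤ.* monomial a′ b′ c′
  monomial-+ a b c a′ b′ c′ = begin
    X ℤ.^ (a + a′) ℤ.* Y ℤ.^ (b + b′) ℤ.* Z ℤ.^ (c + c′)
      ≡⟨ cong₂ ℤ._*_ (cong₂ ℤ._*_ (ℤ.^-distribˡ-+-* X a a′) (ℤ.^-distribˡ-+-* Y b b′)) (ℤ.^-distribˡ-+-* Z c c′) ⟩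
    X ℤ.^ a ℤ.* X ℤ.^ a′ ℤ.* (Y ℤ.^ b ℤ.* Y ℤ.^ b′) ℤ.* (Z ℤ.^ c ℤ.* Z ℤ.^ c′)
      ≡⟨ solve 6 (λ x x′ y y′ z z′ → x :* x′ :* (y :* y′) :* (z :* z′) := x :* y :* z :* (x′ :* y′ :* z′)) refl
           (X ℤ.^ a) (X ℤ.^ a′) (Y ℤ.^ b) (Y ℤ.^ b′) (Z ℤ.^ c) (Z ℤ.^ c′) ⟩
    monomial a b c ℤ.* monomial a′ b′ c′ ∎
    where open ℤ-Solver

-- The exponents of k − 1, k − 2 and k − 3 contributed by an edge from a vertex of kind b₁ to its parent of kind b₂.
exp₁ exp₂ exp₃ : Bool → Bool → ℕ
exp₁ b₁ b₂ = 𝟙 (not b₂)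
exp₂ b₁ b₂ = 𝟙 (b₁ ∨ b₂)
exp₃ b₁ b₂ = 𝟙 b₁ * 𝟙 b₂

edge-monomial : ∀ j b₁ b₂ → let k = 2 + j in
  + (2 ^ 𝟙 b₁ * fibreSize k b₁ b₂) ≡ monomial k (exp₁ b₁ b₂) (exp₂ b₁ b₂) (exp₃ b₁ b₂)
edge-monomial j false false = begin
  + (1 * suc j)                 ≡⟨ cong +_ (*-identityˡ (suc j)) ⟩
  X                               ≡⟨ sym (trans (ℤ.*-identityʳ _) (trans (ℤ.*-identityʳ _) (ℤ.*-identityʳ X))) ⟩
  X ℤ.^ 1 ℤ.* Y ℤ.^ 0 ℤ.* Z ℤ.^ 0 ∎
  where open MonomialNotation (2 + j)
edge-monomial j false true = begin
  + (1 * j)                     ≡⟨ cong +_ (*-identityˡ j) ⟩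
  Y                               ≡⟨ sym (trans (ℤ.*-identityʳ _) (trans (ℤ.*-identityˡ _) (ℤ.*-identityʳ Y))) ⟩
  X ℤ.^ 0 ℤ.* Y ℤ.^ 1 ℤ.* Z ℤ.^ 0 ∎
  where open MonomialNotation (2 + j)
edge-monomial j true false = begin
  + (2 * (suc j C 2))           ≡⟨ cong +_ (C2-double (suc j)) ⟩
  + (suc j * j)                 ≡⟨ ℤ.pos-* (suc j) j ⟩
  X ℤ.* Y                         ≡⟨ sym (trans (ℤ.*-identityʳ _) (cong₂ ℤ._*_ (ℤ.*-identityʳ X) (ℤ.*-identityʳ Y))) ⟩
  X ℤ.^ 1 ℤ.* Y ℤ.^ 1 ℤ.* Z ℤ.^ 0 ∎
  where open MonomialNotation (2 + j)
edge-monomial j true true = begin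
  + (2 * (j C 2))               ≡⟨ cong +_ (C2-double j) ⟩
  + (j * (j ∸ 1))               ≡⟨ lemma j ⟩
  Y ℤ.* Z                         ≡⟨ sym (trans (cong (ℤ._* Z ℤ.^ 1) (ℤ.*-identityˡ (Y ℤ.^ 1)))
                                                (cong₂ ℤ._*_ (ℤ.*-identityʳ Y) (ℤ.*-identityʳ Z))) ⟩
  X ℤ.^ 0 ℤ.* Y ℤ.^ 1 ℤ.* Z ℤ.^ 1 ∎
  where
  open MonomialNotation (2 + j)
  lemma : ∀ j → + (j * (j ∸ 1)) ≡ (+ j) ℤ.* (+ (2 + j) ℤ.- + 3)
  lemma zero    = refl
  lemma (suc j) = ℤ.pos-* (suc j) j

edges-monomial : ∀ j {X : Set} (E : List X) (b₁ b₂ : X → Bool) → let k = 2 + j in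
  + (2 ^ (∑[ e ∈ E ] 𝟙 (b₁ e)) * ∏[ e ∈ E ] fibreSize k (b₁ e) (b₂ e))
    ≡ monomial k (∑[ e ∈ E ] exp₁ (b₁ e) (b₂ e)) (∑[ e ∈ E ] exp₂ (b₁ e) (b₂ e)) (∑[ e ∈ E ] exp₃ (b₁ e) (b₂ e))
edges-monomial j []      b₁ b₂ = refl
edges-monomial j (e ∷ E) b₁ b₂ = begin
  + (2 ^ (𝟙 (b₁ e) + σ) * (f * Π))
    ≡⟨ cong (λ x → + (x * (f * Π))) (^-distribˡ-+-* 2 (𝟙 (b₁ e)) σ) ⟩
  + (2 ^ 𝟙 (b₁ e) * 2 ^ σ * (f * Π))
    ≡⟨ cong +_ (*-Semigroup.interchange (2 ^ 𝟙 (b₁ e)) (2 ^ σ) f Π) ⟩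
  + (2 ^ 𝟙 (b₁ e) * f * (2 ^ σ * Π))
    ≡⟨ ℤ.pos-* (2 ^ 𝟙 (b₁ e) * f) (2 ^ σ * Π) ⟩
  + (2 ^ 𝟙 (b₁ e) * f) ℤ.* + (2 ^ σ * Π)
    ≡⟨ cong₂ ℤ._*_ (edge-monomial j (b₁ e) (b₂ e)) (edges-monomial j E b₁ b₂) ⟩
  monomial k (exp₁ (b₁ e) (b₂ e)) (exp₂ (b₁ e) (b₂ e)) (exp₃ (b₁ e) (b₂ e))
    ℤ.* monomial k (∑[ e ∈ E ] exp₁ (b₁ e) (b₂ e)) (∑[ e ∈ E ] exp₂ (b₁ e) (b₂ e)) (∑[ e ∈ E ] exp₃ (b₁ e) (b₂ e))
    ≡⟨ sym (monomial-+ k (exp₁ (b₁ e) (b₂ e)) (exp₂ (b₁ e) (b₂ e)) (exp₃ (b₁ e) (b₂ e)) _ _ _) ⟩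
  monomial k (∑[ e ∈ e ∷ E ] exp₁ (b₁ e) (b₂ e)) (∑[ e ∈ e ∷ E ] exp₂ (b₁ e) (b₂ e))
             (∑[ e ∈ e ∷ E ] exp₃ (b₁ e) (b₂ e)) ∎
  where
  k = 2 + j
  σ = ∑[ e ∈ E ] 𝟙 (b₁ e)
  f = fibreSize k (b₁ e) (b₂ e)
  Π = ∏[ e ∈ E ] fibreSize k (b₁ e) (b₂ e)

exp₁-split : ∀ b₁ b₂ → 1 + 𝟙 b₁ ≡ exp₁ b₁ b₂ + (𝟙 b₁ + 𝟙 b₂)
exp₁-split false false = refl
exp₁-split false true  = refl
exp₁-split true  false = refl
exp₁-split true  true  = refl

exp₂-split : ∀ b₁ b₂ → 𝟙 b₁ + 𝟙 b₂ ≡ exp₂ b₁ b₂ + exp₃ b₁ b₂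
exp₂-split false false = refl
exp₂-split false true  = refl
exp₂-split true  false = refl
exp₂-split true  true  = refl

monomial-suc : ∀ k a b c → monomial k (suc a) b c ≡ (+ k ℤ.- + 1) ℤ.* monomial k a b c
monomial-suc k a b c = solve 4 (λ x xa yb zc → x :* xa :* yb :* zc := x :* (xa :* yb :* zc)) refl
  (+ k ℤ.- + 1) ((+ k ℤ.- + 1) ℤ.^ a) ((+ k ℤ.- + 2) ℤ.^ b) ((+ k ℤ.- + 3) ℤ.^ c)
  where open ℤ-Solver

root-monomial : ∀ j → let k = 2 + j in + (2 * (k C 2)) ≡ + k ℤ.* (+ k ℤ.- + 1)
root-monomial j = trans (cong +_ (C2-double (2 + j))) (ℤ.pos-* (2 + j) (suc j))

-- The counting identity for trees

∣∣-as-∑ : ∀ {n} (S : Subset n) → ∣ S ∣ ≡ ∑[ u < n ] 𝟙 (lookup S u)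
∣∣-as-∑ []          = refl
∣∣-as-∑ (true ∷ S)  = cong suc (∣∣-as-∑ S)
∣∣-as-∑ (false ∷ S) = ∣∣-as-∑ S

χ-∈? : ∀ {n} (u : Fin n) (S : Subset n) → χ (u ∈? S) ≡ 𝟙 (lookup S u)
χ-∈? zero    (true ∷ S)  = refl
χ-∈? zero    (false ∷ S) = refl
χ-∈? (suc u) (_ ∷ S)     = χ-∈? u S

sum-map-as-∑ₗ : ∀ {A : Set} (f : A → ℕ) (xs : List A) → sum (map f xs) ≡ listSum xs f
sum-map-as-∑ₗ f []       = refl
sum-map-as-∑ₗ f (x ∷ xs) = cong (_+_ (f x)) (sum-map-as-∑ₗ f xs)

module _ {n : ℕ} (G : SimpleGraph n) where
  open SimpleGraph G renaming (sym to Adj-sym)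

  deg-as-∑ : ∀ u → deg G u ≡ ∑[ w < n ] χ (adj? u w)
  deg-as-∑ u = trans (length-filter-as-∑ₗ (adj? u) (allFin n)) (∑ₗ-allFin (λ w → χ (adj? u w)))

  degS-as-∑ : ∀ S → degS G S ≡ ∑[ u < n ] ∑[ w < n ] (χ (adj? u w) * 𝟙 (lookup S u))
  degS-as-∑ S = begin
    sum (map (deg G) (filter (_∈? S) (allFin n)))   ≡⟨ sum-map-as-∑ₗ (deg G) (filter (_∈? S) (allFin n)) ⟩
    ∑[ u ∈ filter (_∈? S) (allFin n) ] deg G u      ≡⟨ ∑ₗ-filter (_∈? S) (allFin n) (deg G) ⟩
    ∑[ u ∈ allFin n ] (χ (u ∈? S) * deg G u)        ≡⟨ ∑ₗ-allFin (λ u → χ (u ∈? S) * deg G u) ⟩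
    ∑[ u < n ] (χ (u ∈? S) * deg G u)               ≡⟨ sum-cong-≗ (λ u → cong₂ _*_ (χ-∈? u S) (deg-as-∑ u)) ⟩
    ∑[ u < n ] (𝟙 (lookup S u) * ∑[ w < n ] χ (adj? u w))
      ≡⟨ sum-cong-≗ (λ u → trans (*-distribˡ-sum (𝟙 (lookup S u)) (λ w → χ (adj? u w)))
                                  (sum-cong-≗ (λ w → *-comm (𝟙 (lookup S u)) (χ (adj? u w))))) ⟩
    ∑[ u < n ] ∑[ w < n ] (χ (adj? u w) * 𝟙 (lookup S u)) ∎

  intS-as-∑ : ∀ S → intS G S ≡ ∑[ u < n ] ∑[ w < n ] (χ (adj? u w) * (χ (u Fin.<? w) * (𝟙 (lookup S u) * 𝟙 (lookup S w))))
  intS-as-∑ S = begin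
    length (filter P? (cartesianProduct (allFin n) (allFin n)))
      ≡⟨ length-filter-as-∑ₗ P? (cartesianProduct (allFin n) (allFin n)) ⟩
    ∑[ t ∈ cartesianProduct (allFin n) (allFin n) ] χ (P? t)
      ≡⟨ ∑ₗ-cartesianProductWith _,_ (allFin n) (allFin n) (χ ∘ P?) ⟩
    ∑[ u ∈ allFin n ] ∑[ w ∈ allFin n ] χ (P? (u , w))
      ≡⟨ trans (∑ₗ-allFin (λ u → ∑[ w ∈ allFin n ] χ (P? (u , w)))) (sum-cong-≗ (λ u → ∑ₗ-allFin (λ w → χ (P? (u , w))))) ⟩
    ∑[ u < n ] ∑[ w < n ] χ (P? (u , w))
      ≡⟨ sum-cong-≗ (λ u → sum-cong-≗ (χ-P? u)) ⟩
    ∑[ u < n ] ∑[ w < n ] (χ (adj? u w) * (χ (u Fin.<? w) * (𝟙 (lookup S u) * 𝟙 (lookup S w)))) ∎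
    where
    P? : ∀ t → Dec _
    P? (u , w) = (u Fin.<? w) ×-dec ((u ∈? S) ×-dec ((w ∈? S) ×-dec adj? u w))
    χ-P? : ∀ u w → χ (P? (u , w)) ≡ χ (adj? u w) * (χ (u Fin.<? w) * (𝟙 (lookup S u) * 𝟙 (lookup S w)))
    χ-P? u w rewrite χ-× (u Fin.<? w) ((u ∈? S) ×-dec ((w ∈? S) ×-dec adj? u w))
                   | χ-× (u ∈? S) ((w ∈? S) ×-dec adj? u w)
                   | χ-× (w ∈? S) (adj? u w) | χ-∈? u S | χ-∈? w S =
      solve 4 (λ a b c d → a :* (b :* (c :* d)) := d :* (a :* (b :* c))) refl (χ (u Fin.<? w)) (𝟙 (lookup S u)) (𝟙 (lookup S w)) (χ (adj? u w))
      where open ℕ-Solver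

  edges-adjacent : ∀ {r A} (g : Growth G r A) → All (λ e → Adj (proj₁ e) (proj₂ e)) (edges G g)
  edges-adjacent root                     = []
  edges-adjacent (attach g _ _ _ _ alp _) = alp ∷ edges-adjacent g

  module _ {r A} (g : Growth G r A) (spanning : ∀ u → A u ≡ true) where

    private
      𝟙-spanning : ∀ u x → 𝟙 (A u) * x ≡ x
      𝟙-spanning u x rewrite spanning u = *-identityˡ x

    ∑-spanning-vertices : ∀ f → ∑[ u < n ] f u ≡ f r + ∑[ e ∈ edges G g ] f (proj₁ e)
    ∑-spanning-vertices f = trans (sum-cong-≗ (λ u → sym (𝟙-spanning u (f u)))) (∑-growth-vertices G g f)

    ∑-spanning-edges : ∀ f → ∑[ u < n ] ∑[ w < n ] (χ (adj? u w) * f u w)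
                             ≡ ∑[ e ∈ edges G g ] (f (proj₁ e) (proj₂ e) + f (proj₂ e) (proj₁ e))
    ∑-spanning-edges f = trans (sum-cong-≗ (λ u → sum-cong-≗ (λ w → sym (both u w)))) (∑-growth-edges G g f)
      where
      both : ∀ u w → 𝟙 (A u) * 𝟙 (A w) * (χ (adj? u w) * f u w) ≡ χ (adj? u w) * f u w
      both u w rewrite spanning u | spanning w = *-identityˡ _

compatibleStates : ∀ {n} → SimpleGraph n → (k : ℕ) → Subset n → List (Vec (State k) n)
compatibleStates G k S = compatibleLabellings G (Disjoint k) (disjoint? k) (λ u → states k (lookup S u))

term-as-monomial : ∀ {n} (T : SimpleGraph n) k d S →
  term T k d S ≡ + k ℤ.* monomial k (n + d ∸ 1 ∸ degS T S) (degS T S ∸ intS T S) (intS T S)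
term-as-monomial {n} T k d S =
  solve 4 (λ c x y z → c :* x :* y :* z := c :* (x :* y :* z)) refl
    (+ k) ((+ k ℤ.- + 1) ℤ.^ (n + d ∸ 1 ∸ degS T S)) ((+ k ℤ.- + 2) ℤ.^ (degS T S ∸ intS T S)) ((+ k ℤ.- + 3) ℤ.^ intS T S)
  where open ℤ-Solver

module _ {n : ℕ} (T : SimpleGraph (suc n)) (S : Subset (suc n))
         {r A} (g : Growth T r A) (spanning : ∀ u → A u ≡ true) (r∈S : lookup S r ≡ true) where
  open SimpleGraph T renaming (sym to Adj-sym)

  private
    E = edges T g
    σ : Fin (suc n) → ℕ
    σ u = 𝟙 (lookup S u)
    b₁ b₂ : Fin (suc n) × Fin (suc n) → Bool
    b₁ e = lookup S (proj₁ e)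
    b₂ e = lookup S (proj₂ e)
    Σ₁ Σ₂ Σ₃ : ℕ
    Σ₁ = ∑[ e ∈ E ] exp₁ (b₁ e) (b₂ e)
    Σ₂ = ∑[ e ∈ E ] exp₂ (b₁ e) (b₂ e)
    Σ₃ = ∑[ e ∈ E ] exp₃ (b₁ e) (b₂ e)

  vertex-count : n ≡ ∑[ e ∈ E ] 1
  vertex-count = suc-injective (trans (sym (∑-const (suc n))) (∑-spanning-vertices T g spanning (λ _ → 1)))

  ∣S∣-count : ∣ S ∣ ≡ suc (∑[ e ∈ E ] 𝟙 (b₁ e))
  ∣S∣-count = begin
    ∣ S ∣                          ≡⟨ ∣∣-as-∑ S ⟩
    ∑[ u < suc n ] σ u             ≡⟨ ∑-spanning-vertices T g spanning σ ⟩
    σ r + ∑[ e ∈ E ] 𝟙 (b₁ e)      ≡⟨ cong (λ b → 𝟙 b + ∑[ e ∈ E ] 𝟙 (b₁ e)) r∈S ⟩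
    suc (∑[ e ∈ E ] 𝟙 (b₁ e))      ∎

  degS-count : degS T S ≡ ∑[ e ∈ E ] (𝟙 (b₁ e) + 𝟙 (b₂ e))
  degS-count = trans (degS-as-∑ T S) (∑-spanning-edges T g spanning (λ u _ → σ u))

  intS-count : intS T S ≡ Σ₃
  intS-count = begin
    intS T S
      ≡⟨ intS-as-∑ T S ⟩
    ∑[ u < suc n ] ∑[ w < suc n ] (χ (adj? u w) * (χ (u Fin.<? w) * (σ u * σ w)))
      ≡⟨ ∑-spanning-edges T g spanning (λ u w → χ (u Fin.<? w) * (σ u * σ w)) ⟩
    ∑[ e ∈ E ] (χ (proj₁ e Fin.<? proj₂ e) * (σ (proj₁ e) * σ (proj₂ e)) + χ (proj₂ e Fin.<? proj₁ e) * (σ (proj₂ e) * σ (proj₁ e)))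
      ≡⟨ ∑ₗ-cong-∈ E (λ e∈ → one-orientation (All.lookup (edges-adjacent T g) e∈)) ⟩
    ∑[ e ∈ E ] exp₃ (b₁ e) (b₂ e) ∎
    where
    one-orientation : ∀ {l p} → Adj l p → χ (l Fin.<? p) * (σ l * σ p) + χ (p Fin.<? l) * (σ p * σ l) ≡ σ l * σ p
    one-orientation {l} {p} alp with Fin.<-cmp l p
    ... | tri< l<p _ p≮l rewrite χ-yes (l Fin.<? p) l<p | χ-no (p Fin.<? l) p≮l = trans (+-identityʳ _) (+-identityʳ _)
    ... | tri> l≮p _ p<l rewrite χ-no (l Fin.<? p) l≮p | χ-yes (p Fin.<? l) p<l = trans (+-identityʳ _) (*-comm (σ p) (σ l))
    ... | tri≈ _ refl _  = contradiction alp irrefl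

  exponent₁ : suc n + ∣ S ∣ ∸ 1 ∸ degS T S ≡ suc Σ₁
  exponent₁ = begin
    n + ∣ S ∣ ∸ degS T S               ≡⟨ cong (_∸ degS T S) split ⟩
    suc Σ₁ + degS T S ∸ degS T S       ≡⟨ m+n∸n≡m (suc Σ₁) (degS T S) ⟩
    suc Σ₁                             ∎
    where
    split : n + ∣ S ∣ ≡ suc Σ₁ + degS T S
    split = begin
      n + ∣ S ∣                                          ≡⟨ cong₂ _+_ vertex-count ∣S∣-count ⟩
      ∑[ e ∈ E ] 1 + suc (∑[ e ∈ E ] 𝟙 (b₁ e))            ≡⟨ +-suc _ _ ⟩
      suc (∑[ e ∈ E ] 1 + ∑[ e ∈ E ] 𝟙 (b₁ e))            ≡⟨ cong suc (sym (∑ₗ-distrib-+ E (λ _ → 1) (𝟙 ∘ b₁))) ⟩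
      suc (∑[ e ∈ E ] (1 + 𝟙 (b₁ e)))                    ≡⟨ cong suc (∑ₗ-cong E (λ e → exp₁-split (b₁ e) (b₂ e))) ⟩
      suc (∑[ e ∈ E ] (exp₁ (b₁ e) (b₂ e) + (𝟙 (b₁ e) + 𝟙 (b₂ e))))
                                                         ≡⟨ cong suc (∑ₗ-distrib-+ E (λ e → exp₁ (b₁ e) (b₂ e)) _) ⟩
      suc (Σ₁ + ∑[ e ∈ E ] (𝟙 (b₁ e) + 𝟙 (b₂ e)))        ≡⟨ cong (λ x → suc (Σ₁ + x)) (sym degS-count) ⟩
      suc Σ₁ + degS T S                                  ∎

  exponent₂ : degS T S ∸ intS T S ≡ Σ₂
  exponent₂ = begin
    degS T S ∸ intS T S                       ≡⟨ cong₂ _∸_ split intS-count ⟩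
    Σ₂ + Σ₃ ∸ Σ₃                              ≡⟨ m+n∸n≡m Σ₂ Σ₃ ⟩
    Σ₂                                        ∎
    where
    split : degS T S ≡ Σ₂ + Σ₃
    split = trans degS-count (trans (∑ₗ-cong E (λ e → exp₂-split (b₁ e) (b₂ e))) (∑ₗ-distrib-+ E _ _))

  compatibleStates-count : ∀ k′ → let k = suc k′ in
    length (compatibleStates T k S) ≡ (k C 2) * ∏[ e ∈ E ] fibreSize k (b₁ e) (b₂ e)
  compatibleStates-count k′ = begin
    length (compatibleStates T k S)
      ≡⟨ length-compatibleLabellings T (Disjoint k) (disjoint? k) (Disjoint-sym k) (λ u → states k (lookup S u)) (zero , zero)
           (λ l p → fibreSize k (lookup S l) (lookup S p)) (λ {l} _ t∈ → ∑-disjoint k (lookup S l) t∈) g spanning ⟩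
    length (states k (lookup S r)) * Π
      ≡⟨ cong (λ b → length (states k b) * Π) r∈S ⟩
    length (increasingPairs k) * Π
      ≡⟨ cong (_* Π) (length-increasingPairs k) ⟩
    (k C 2) * Π ∎
    where
    k = suc k′
    Π = ∏[ e ∈ E ] fibreSize k (b₁ e) (b₂ e)

  private
    exponents-monomial : ∀ k → term T k ∣ S ∣ S ≡ + k ℤ.* monomial k (suc Σ₁) Σ₂ Σ₃
    exponents-monomial k = trans (term-as-monomial T k ∣ S ∣ S)
      (cong (λ (a , b , c) → + k ℤ.* monomial k a b c) (cong₂ _,_ exponent₁ (cong₂ _,_ exponent₂ intS-count)))

  -- For k = 1 the truncated k ∸ 2 breaks edge-monomial; instead both sides vanish, since the root
  -- lies in S and so has no pair of colours, while contributing a factor k − 1 to the right-hand side.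
  tree-identity-growth : ∀ k → 1 ≤ k → + (2 ^ ∣ S ∣ * length (compatibleStates T k S)) ≡ term T k ∣ S ∣ S
  tree-identity-growth (suc zero) _ = begin
    + (2 ^ ∣ S ∣ * length (compatibleStates T 1 S))   ≡⟨ cong (λ m → + (2 ^ ∣ S ∣ * m)) (compatibleStates-count 0) ⟩
    + (2 ^ ∣ S ∣ * 0)                                 ≡⟨ cong +_ (*-zeroʳ (2 ^ ∣ S ∣)) ⟩
    + 1 ℤ.* monomial 1 (suc Σ₁) Σ₂ Σ₃                 ≡⟨ sym (exponents-monomial 1) ⟩
    term T 1 ∣ S ∣ S                                  ∎
  tree-identity-growth (suc (suc j)) _ = begin
    + (2 ^ ∣ S ∣ * length (compatibleStates T k S))
      ≡⟨ cong₂ (λ d m → + (2 ^ d * m)) ∣S∣-count (compatibleStates-count (suc j)) ⟩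
    + (2 * 2 ^ σₑ * ((k C 2) * Π))
      ≡⟨ cong +_ (*-Semigroup.interchange 2 (2 ^ σₑ) (k C 2) Π) ⟩
    + (2 * (k C 2) * (2 ^ σₑ * Π))
      ≡⟨ ℤ.pos-* (2 * (k C 2)) (2 ^ σₑ * Π) ⟩
    + (2 * (k C 2)) ℤ.* + (2 ^ σₑ * Π)
      ≡⟨ cong₂ ℤ._*_ (root-monomial j) (edges-monomial j E b₁ b₂) ⟩
    + k ℤ.* (+ k ℤ.- + 1) ℤ.* monomial k Σ₁ Σ₂ Σ₃
      ≡⟨ ℤ.*-assoc (+ k) (+ k ℤ.- + 1) (monomial k Σ₁ Σ₂ Σ₃) ⟩
    + k ℤ.* ((+ k ℤ.- + 1) ℤ.* monomial k Σ₁ Σ₂ Σ₃)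
      ≡⟨ cong (+ k ℤ.*_) (sym (monomial-suc k Σ₁ Σ₂ Σ₃)) ⟩
    + k ℤ.* monomial k (suc Σ₁) Σ₂ Σ₃
      ≡⟨ sym (exponents-monomial k) ⟩
    term T k ∣ S ∣ S ∎
    where
    k = suc (suc j)
    σₑ = ∑[ e ∈ E ] 𝟙 (b₁ e)
    Π = ∏[ e ∈ E ] fibreSize k (b₁ e) (b₂ e)

∃-member : ∀ {n} (S : Subset n) → 1 ≤ ∣ S ∣ → ∃ λ r → lookup S r ≡ true
∃-member (true ∷ S)  _ = zero , refl
∃-member (false ∷ S) h with ∃-member S h
... | r , r∈S = suc r , r∈S

tree-identity : ∀ {n} (T : SimpleGraph n) → IsTree T → ∀ k → 1 ≤ k → (S : Subset n) → 1 ≤ ∣ S ∣ →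
  + (2 ^ ∣ S ∣ * length (compatibleStates T k S)) ≡ term T k ∣ S ∣ S
tree-identity {zero}  T _                     k _   [] ()
tree-identity {suc n} T (connected , acyclic) k 1≤k S 1≤∣S∣ with ∃-member S 1≤∣S∣
... | r , r∈S with spanningGrowth T connected acyclic r
... | A , g , spanning = tree-identity-growth T S g spanning r∈S k 1≤k

vec-ext : {a b : Vec A n} → (∀ i → lookup a i ≡ lookup b i) → a ≡ b
vec-ext {a = a} {b} e = trans (sym (Vec.tabulate∘lookup a)) (trans (Vec.tabulate-cong e) (Vec.tabulate∘lookup b))

record DiffersOnlyAt (a b : Vec A n) (u : Fin n) : Set where
  constructor ⟨_,_⟩
  field
    differs : lookup a u ≢ lookup b u
    agrees  : ∀ w → w ≢ u → lookup a w ≡ lookup b w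

open DiffersOnlyAt

DiffersOnlyAt-sym : {a b : Vec A n} {u : Fin n} → DiffersOnlyAt a b u → DiffersOnlyAt b a u
DiffersOnlyAt-sym ⟨ a≢b , agree ⟩ = ⟨ a≢b ∘ sym , (λ w w≢u → sym (agree w w≢u)) ⟩

DiffersOnlyAt-unique : {a b : Vec A n} {u u′ : Fin n} → DiffersOnlyAt a b u → DiffersOnlyAt a b u′ → u ≡ u′
DiffersOnlyAt-unique {u = u} {u′} ⟨ a≢b , _ ⟩ ⟨ _ , agree′ ⟩ with u Fin.≟ u′
... | yes u≡u′ = u≡u′
... | no  u≢u′ = contradiction (agree′ u u≢u′) a≢b

module _ (_≟_ : DecidableEquality A) where

  hamming≡0⇒≡ : (a b : Vec A n) → hamming _≟_ a b ≡ 0 → a ≡ b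
  hamming≡0⇒≡ []       []       _ = refl
  hamming≡0⇒≡ (x ∷ a) (y ∷ b) h with x ≟ y
  ... | yes refl = cong (x ∷_) (hamming≡0⇒≡ a b h)

  hamming-refl : (a : Vec A n) → hamming _≟_ a a ≡ 0
  hamming-refl []      = refl
  hamming-refl (x ∷ a) with x ≟ x
  ... | yes _  = hamming-refl a
  ... | no x≢x = contradiction refl x≢x

  hamming≡1⇒differsOnlyAt : (a b : Vec A n) → hamming _≟_ a b ≡ 1 → ∃ (DiffersOnlyAt a b)
  hamming≡1⇒differsOnlyAt []      []      ()
  hamming≡1⇒differsOnlyAt (x ∷ a) (y ∷ b) h with x ≟ y
  ... | yes x≡y with u , ⟨ a≢b , agree ⟩ ← hamming≡1⇒differsOnlyAt a b h =
    suc u , ⟨ a≢b , (λ { zero _ → x≡y ; (suc w) w≢u → agree w (w≢u ∘ cong suc) }) ⟩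
  ... | no  x≢y with refl ← hamming≡0⇒≡ a b (cong pred h) =
    zero , ⟨ x≢y , (λ { zero 0≢0 → contradiction refl 0≢0 ; (suc w) _ → refl }) ⟩

  differsOnlyAt⇒hamming≡1 : (a b : Vec A n) (u : Fin n) → DiffersOnlyAt a b u → hamming _≟_ a b ≡ 1
  differsOnlyAt⇒hamming≡1 (x ∷ a) (y ∷ b) zero ⟨ x≢y , agree ⟩ with x ≟ y
  ... | yes x≡y = contradiction x≡y x≢y
  ... | no _ rewrite vec-ext {a = a} {b} (λ w → agree (suc w) λ ()) = cong suc (hamming-refl b)
  differsOnlyAt⇒hamming≡1 (x ∷ a) (y ∷ b) (suc u) ⟨ a≢b , agree ⟩ with x ≟ y
  ... | yes _   = differsOnlyAt⇒hamming≡1 a b u ⟨ a≢b , (λ w w≢u → agree (suc w) (w≢u ∘ Fin.suc-injective)) ⟩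
  ... | no  x≢y = contradiction (agree zero λ ()) x≢y

flip : Fin n → Vec Bool n → Vec Bool n
flip i x = updateAt x i not

flip-differsOnlyAt : ∀ (i : Fin n) x → DiffersOnlyAt x (flip i x) i
flip-differsOnlyAt i x =
  ⟨ (λ e → Bool.not-¬ refl (trans e (Vec.lookup∘updateAt i x))) , (λ w w≢i → sym (Vec.lookup∘updateAt′ w i w≢i x)) ⟩

flip-involutive : ∀ (i : Fin n) x → flip i (flip i x) ≡ x
flip-involutive i x = trans (Vec.updateAt-updateAt-local i x (Bool.not-involutive _)) (Vec.updateAt-id i x)

flip-comm : ∀ (i j : Fin n) x → flip i (flip j x) ≡ flip j (flip i x)
flip-comm i j x with i Fin.≟ j
... | yes refl = refl
... | no  i≢j  = Vec.updateAt-commutes i j i≢j x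

flip-flip-≢ : ∀ {i j : Fin n} x → i ≢ j → x ≢ flip j (flip i x)
flip-flip-≢ {i = i} {j} x i≢j e = Bool.not-¬ refl (begin
  lookup x i                     ≡⟨ cong (λ y → lookup y i) e ⟩
  lookup (flip j (flip i x)) i   ≡⟨ Vec.lookup∘updateAt′ i j i≢j (flip i x) ⟩
  lookup (flip i x) i            ≡⟨ Vec.lookup∘updateAt i x ⟩
  not (lookup x i)               ∎)

flip-flip-¬differsOnlyAt : ∀ {i j : Fin n} x → i ≢ j → ∀ u → ¬ DiffersOnlyAt x (flip j (flip i x)) u
flip-flip-¬differsOnlyAt {i = i} {j} x i≢j u ⟨ _ , agree ⟩ with u Fin.≟ i
... | yes refl = Bool.not-¬ refl (begin
      lookup x j                     ≡⟨ agree j (i≢j ∘ sym) ⟩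
      lookup (flip j (flip i x)) j   ≡⟨ Vec.lookup∘updateAt j (flip i x) ⟩
      not (lookup (flip i x) j)      ≡⟨ cong not (Vec.lookup∘updateAt′ j i (i≢j ∘ sym) x) ⟩
      not (lookup x j)               ∎)
... | no u≢i = Bool.not-¬ refl (begin
      lookup x i                     ≡⟨ agree i (u≢i ∘ sym) ⟩
      lookup (flip j (flip i x)) i   ≡⟨ Vec.lookup∘updateAt′ i j i≢j (flip i x) ⟩
      lookup (flip i x) i            ≡⟨ Vec.lookup∘updateAt i x ⟩
      not (lookup x i)               ∎)

cube-induction : (P : Vec Bool n → Set) → P (replicate n false) → (∀ x j → P x → P (flip j x)) → ∀ x → P x
cube-induction {zero}  P p₀ step []          = p₀
cube-induction {suc n} P p₀ step (false ∷ x) = cube-induction (P ∘ (false ∷_)) p₀ (λ y j → step (false ∷ y) (suc j)) x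
cube-induction {suc n} P p₀ step (true ∷ x)  =
  step (false ∷ x) zero (cube-induction (P ∘ (false ∷_)) p₀ (λ y j → step (false ∷ y) (suc j)) x)

module _ (_≟_ : DecidableEquality A) where

  FarApart : Vec A n → Vec A n → Set
  FarApart a b = a ≢ b × (∀ t → ¬ DiffersOnlyAt a b t)

  differsOnlyAt-twice : ∀ {a b c : Vec A n} {u} → DiffersOnlyAt a b u → DiffersOnlyAt b c u → ¬ FarApart a c
  differsOnlyAt-twice {a = a} {b} {c} {u} ⟨ _ , a≈b ⟩ ⟨ _ , b≈c ⟩ (a≢c , ¬adjacent) with lookup a u ≟ lookup c u
  ... | yes au≡cu = a≢c (vec-ext agree)
    where
    agree : ∀ t → lookup a t ≡ lookup c t
    agree t with t Fin.≟ u
    ... | yes refl = au≡cu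
    ... | no t≢u   = trans (a≈b t t≢u) (b≈c t t≢u)
  ... | no au≢cu = ¬adjacent u ⟨ au≢cu , (λ t t≢u → trans (a≈b t t≢u) (b≈c t t≢u)) ⟩

  differs⇒changed : ∀ {a b c : Vec A n} {u y z} → DiffersOnlyAt a b z → DiffersOnlyAt c b y →
    lookup a u ≢ lookup c u → u ≡ z ⊎ u ≡ y
  differs⇒changed {u = u} {y} {z} ⟨ _ , a≈b ⟩ ⟨ _ , c≈b ⟩ au≢cu with u Fin.≟ z | u Fin.≟ y
  ... | yes u≡z | _       = inj₁ u≡z
  ... | no _    | yes u≡y = inj₂ u≡y
  ... | no u≢z  | no u≢y  = contradiction (trans (a≈b u u≢z) (sym (c≈b u u≢y))) au≢cu

  square : ∀ {c₁ c₂ c₃ c₄ : Vec A n} {u w y z} →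
    DiffersOnlyAt c₁ c₂ u → DiffersOnlyAt c₂ c₃ w → DiffersOnlyAt c₃ c₄ y → DiffersOnlyAt c₄ c₁ z →
    FarApart c₁ c₃ → FarApart c₂ c₄ →
    w ≢ u × DiffersOnlyAt c₄ c₃ u × lookup c₄ u ≡ lookup c₁ u × lookup c₃ u ≡ lookup c₂ u
  square {c₁ = c₁} {c₂} {c₃} {c₄} {u} {w} {y} {z} d₁₂ d₂₃ d₃₄ d₄₁ far₁₃ far₂₄ =
    w≢u , subst (DiffersOnlyAt c₄ c₃) y≡u (DiffersOnlyAt-sym d₃₄) , agrees d₄₁ u u≢z , sym (agrees d₂₃ u u≢w)
    where
    w≢u : w ≢ u
    w≢u refl = differsOnlyAt-twice d₁₂ d₂₃ far₁₃
    u≢w = w≢u ∘ sym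
    c₁u≢c₃u : lookup c₁ u ≢ lookup c₃ u
    c₁u≢c₃u e = differs d₁₂ (trans e (sym (agrees d₂₃ u u≢w)))
    c₁w≢c₃w : lookup c₁ w ≢ lookup c₃ w
    c₁w≢c₃w e = differs d₂₃ (trans (sym (agrees d₁₂ w w≢u)) e)
    z≢u : z ≢ u
    z≢u refl = differsOnlyAt-twice (DiffersOnlyAt-sym d₁₂) (DiffersOnlyAt-sym d₄₁) far₂₄
    y≡u : y ≡ u
    y≡u with differs⇒changed (DiffersOnlyAt-sym d₄₁) d₃₄ c₁u≢c₃u
    ... | inj₁ u≡z = contradiction (sym u≡z) z≢u
    ... | inj₂ u≡y = sym u≡y
    u≢z : u ≢ z
    u≢z u≡z with differs⇒changed (DiffersOnlyAt-sym d₄₁) d₃₄ c₁w≢c₃w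
    ... | inj₁ w≡z = w≢u (trans w≡z (sym u≡z))
    ... | inj₂ w≡y = w≢u (trans w≡y y≡u)

sizedSubsets : ∀ N → ℕ → List (Subset N)
sizedSubsets N d = filter (λ S → ∣ S ∣ ℕ.≟ d) (allSubsets N)

concatMap-map≡cartesianProductWith : ∀ {C : Set} (f : A → B → C) xs ys →
  concatMap (λ x → map (f x) ys) xs ≡ cartesianProductWith f xs ys
concatMap-map≡cartesianProductWith f []       ys = refl
concatMap-map≡cartesianProductWith f (x ∷ xs) ys = cong (map (f x) ys ++_) (concatMap-map≡cartesianProductWith f xs ys)

allVecs≡choices : ∀ k n → allVecs k n ≡ choices (λ (_ : Fin n) → allFin k)
allVecs≡choices k zero    = refl
allVecs≡choices k (suc n) = trans (cong (λ vs → concatMap (λ c → map (c ∷_) vs) (allFin k)) (allVecs≡choices k n))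
                                  (concatMap-map≡cartesianProductWith _∷_ (allFin k) _)

∈-allSubsets : ∀ {n} (S : Subset n) → S ∈ allSubsets n
∈-allSubsets []                = here refl
∈-allSubsets (false ∷ S)       = ∈-++⁺ˡ (∈-map⁺ (false ∷_) (∈-allSubsets S))
∈-allSubsets {suc n} (true ∷ S) = ∈-++⁺ʳ (map (false ∷_) (allSubsets n)) (∈-map⁺ (true ∷_) (∈-allSubsets S))

allSubsets-unique : ∀ n → Unique (allSubsets n)
allSubsets-unique zero    = All.[] ∷ []
allSubsets-unique (suc n) =
  Unique.++⁺ (Unique.map⁺ Vec.∷-injectiveʳ (allSubsets-unique n)) (Unique.map⁺ Vec.∷-injectiveʳ (allSubsets-unique n)) disjoint
  where
  disjoint : ∀ {S} → S ∈ map (false ∷_) (allSubsets n) × S ∈ map (true ∷_) (allSubsets n) → ⊥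
  disjoint (S∈₀ , S∈₁) with ∈-map⁻ (false ∷_) S∈₀ | ∈-map⁻ (true ∷_) S∈₁
  ... | _ , _ , refl | _ , _ , ()

module _ {n : ℕ} (G : SimpleGraph n) (k : ℕ) where

  properCols-unique : Unique (properCols G k)
  properCols-unique = Unique.filter⁺ (proper? G)
    (subst Unique (sym (allVecs≡choices k n)) (choices-unique _ (λ _ → Unique.allFin⁺ k)))

  col-injective : ∀ i j → col G k i ≡ col G k j → i ≡ j
  col-injective = lookup-injective properCols-unique

  col-proper : ∀ i → Proper G (col G k i)
  col-proper i = proj₂ (∈-filter⁻ (proper? G) {xs = allVecs k n} (∈-lookup i))

  col-surjective : ∀ c → Proper G c → ∃ λ i → col G k i ≡ c
  col-surjective c proper = index c∈ , sym (lookup-index c∈)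
    where
    c∈ : c ∈ properCols G k
    c∈ = ∈-filter⁺ (proper? G) (subst (c ∈_) (sym (allVecs≡choices k n)) (∈-choices⁺ _ (λ u → ∈-allFin (lookup c u)))) proper

module _ {k : ℕ} where

  _∈ₛ_ : Fin k → State k → Set
  a ∈ₛ t = a ≡ proj₁ t ⊎ a ≡ proj₂ t

  _∈ₛ?_ : ∀ a t → Dec (a ∈ₛ t)
  a ∈ₛ? t = (a Fin.≟ proj₁ t) ⊎-dec (a Fin.≟ proj₂ t)

  Disjoint⇒≢ : ∀ {t t′ a a′} → Disjoint k t t′ → a ∈ₛ t → a′ ∈ₛ t′ → a ≢ a′
  Disjoint⇒≢ (≢₁₁ , _ , _ , _) (inj₁ refl) (inj₁ refl) = ≢₁₁
  Disjoint⇒≢ (_ , ≢₁₂ , _ , _) (inj₁ refl) (inj₂ refl) = ≢₁₂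
  Disjoint⇒≢ (_ , _ , ≢₂₁ , _) (inj₂ refl) (inj₁ refl) = ≢₂₁
  Disjoint⇒≢ (_ , _ , _ , ≢₂₂) (inj₂ refl) (inj₂ refl) = ≢₂₂

module _ {N : ℕ} (G : SimpleGraph N) (k : ℕ) where

  InBox : Vec (State k) N → Vec (Fin k) N → Set
  InBox s c = ∀ u → lookup c u ∈ₛ lookup s u

  inBox? : ∀ s c → Dec (InBox s c)
  inBox? s c = Fin.all? λ u → lookup c u ∈ₛ? lookup s u

  inBox⇒proper : ∀ {s c} → Compatible G (Disjoint k) s → InBox s c → Proper G c
  inBox⇒proper compatible inBox u v auv = Disjoint⇒≢ (compatible u v auv) (inBox u) (inBox v)

  box : Vec (State k) N → Subset (nCols G k)
  box s = tabulate (λ i → does (inBox? s (col G k i)))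

  lookup-box : ∀ s i → lookup (box s) i ≡ does (inBox? s (col G k i))
  lookup-box s i = Vec.lookup∘tabulate (λ i → does (inBox? s (col G k i))) i

  InStates : Subset N → Vec (State k) N → Set
  InStates S s = ∀ u → lookup s u ∈ states k (lookup S u)

  canonicalStates : ℕ → List (Vec (State k) N)
  canonicalStates d = concatMap (compatibleStates G k) (sizedSubsets N d)

  Canonical : ℕ → Vec (State k) N → Set
  Canonical d s = ∃ λ S → ∣ S ∣ ≡ d × InStates S s × Compatible G (Disjoint k) s

  ∈-canonicalStates⁻ : ∀ {d s} → s ∈ canonicalStates d → Canonical d s
  ∈-canonicalStates⁻ {d} {s} s∈ with find (∈-concatMap⁻ (compatibleStates G k) {xs = sizedSubsets N d} s∈)
  ... | S , S∈ , s∈S with ∈-filter⁻ (λ S → ∣ S ∣ ℕ.≟ d) {xs = allSubsets N} S∈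
                        | ∈-filter⁻ (compatible? G (Disjoint k) (disjoint? k)) {xs = choices (λ u → states k (lookup S u))} s∈S
  ... | _ , ∣S∣≡d | s∈choices , compatible = S , ∣S∣≡d , ∈-choices⁻ _ s∈choices , compatible

  ∈-canonicalStates⁺ : ∀ {d s} → Canonical d s → s ∈ canonicalStates d
  ∈-canonicalStates⁺ (S , ∣S∣≡d , inStates , compatible) =
    ∈-concatMap⁺ (compatibleStates G k) (lose (∈-filter⁺ (λ S → ∣ S ∣ ℕ.≟ _) (∈-allSubsets S) ∣S∣≡d)
                                               (∈-filter⁺ (compatible? G (Disjoint k) (disjoint? k)) (∈-choices⁺ _ inStates) compatible))

  InStates-unique : ∀ {S S′ s} → InStates S s → InStates S′ s → S ≡ S′
  InStates-unique {S} {S′} {s} in₁ in₂ = vec-ext same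
    where
    same : ∀ u → lookup S u ≡ lookup S′ u
    same u with lookup S u | lookup S′ u | in₁ u | in₂ u
    ... | true  | true  | _  | _  = refl
    ... | false | false | _  | _  = refl
    ... | true  | false | t∈ | t∈′ = contradiction (∈-states-false⁻ t∈′) (Fin.<⇒≢ (∈-states-true⁻ t∈))
    ... | false | true  | t∈ | t∈′ = contradiction (∈-states-false⁻ t∈) (Fin.<⇒≢ (∈-states-true⁻ t∈′))

  canonicalStates-unique : ∀ d → Unique (canonicalStates d)
  canonicalStates-unique d = Unique.concat⁺
    (All.map⁺ (All.tabulate (λ {S} _ → Unique.filter⁺ _ (choices-unique _ (λ u → states-unique (lookup S u))))))
    (AllPairs.map⁺ (AllPairs.map disjoint (Unique.filter⁺ _ (allSubsets-unique N))))
    where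
    in-states : ∀ {S s} → s ∈ compatibleStates G k S → InStates S s
    in-states {S} s∈ = ∈-choices⁻ (λ u → states k (lookup S u))
      (proj₁ (∈-filter⁻ (compatible? G (Disjoint k) (disjoint? k)) {xs = choices (λ u → states k (lookup S u))} s∈))
    disjoint : ∀ {S S′} → S ≢ S′ → ∀ {s} → s ∈ compatibleStates G k S × s ∈ compatibleStates G k S′ → ⊥
    disjoint {S} {S′} S≢S′ {s} (s∈ , s∈′) = S≢S′ (InStates-unique {S} {S′} {s} (in-states {S} s∈) (in-states {S′} s∈′))

  length-canonicalStates : ∀ d → length (canonicalStates d) ≡ ∑[ S ∈ sizedSubsets N d ] length (compatibleStates G k S)
  length-canonicalStates d = trans (length-as-∑ₗ (canonicalStates d))
    (trans (∑ₗ-concatMap (compatibleStates G k) (sizedSubsets N d) (λ _ → 1))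
           (∑ₗ-cong (sizedSubsets N d) (λ S → sym (length-as-∑ₗ (compatibleStates G k S)))))

-- Direction i of the cube recolours a single vertex v i, between the colours α i and β i.
module InducedCube {A : Set} (_≟_ : DecidableEquality A) {d N : ℕ} (c : Vec Bool d → Vec A N)
  (c-injective : ∀ x y → c x ≡ c y → x ≡ y)
  (c-adjacent  : ∀ x y → ∃ (DiffersOnlyAt x y) → ∃ (DiffersOnlyAt (c x) (c y)))
  (c-adjacent⁻ : ∀ x y → ∃ (DiffersOnlyAt (c x) (c y)) → ∃ (DiffersOnlyAt x y)) where

  origin : Vec Bool d
  origin = replicate d false

  step : ∀ x j → ∃ (DiffersOnlyAt (c x) (c (flip j x)))
  step x j = c-adjacent x (flip j x) (j , flip-differsOnlyAt j x)

  farApart : ∀ x {i j} → i ≢ j → FarApart _≟_ (c x) (c (flip j (flip i x)))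
  farApart x i≢j = (λ e → flip-flip-≢ x i≢j (c-injective _ _ e))
                 , (λ t diff → flip-flip-¬differsOnlyAt x i≢j _ (proj₂ (c-adjacent⁻ _ _ (t , diff))))

  v : Fin d → Fin N
  v i = proj₁ (step origin i)

  α β : Fin d → A
  α i = lookup (c origin) (v i)
  β i = lookup (c (flip i origin)) (v i)

  Along : Fin d → Vec Bool d → Set
  Along i x = DiffersOnlyAt (c x) (c (flip i x)) (v i)
            × lookup (c x) (v i) ≡ (if lookup x i then β i else α i)
            × lookup (c (flip i x)) (v i) ≡ (if lookup x i then α i else β i)

  along-origin : ∀ i → Along i origin
  along-origin i = proj₂ (step origin i) , cong (if_then β i else α i) (sym (Vec.lookup-replicate i false))
                                         , cong (if_then α i else β i) (sym (Vec.lookup-replicate i false))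

  private
    square-at : ∀ x {i j} → i ≢ j → DiffersOnlyAt (c x) (c (flip i x)) (v i) →
      proj₁ (step (flip i x) j) ≢ v i × DiffersOnlyAt (c (flip j x)) (c (flip j (flip i x))) (v i)
      × lookup (c (flip j x)) (v i) ≡ lookup (c x) (v i) × lookup (c (flip j (flip i x))) (v i) ≡ lookup (c (flip i x)) (v i)
    square-at x {i} {j} i≢j d₁₂ = square _≟_ d₁₂ (proj₂ (step (flip i x) j)) d₃₄ (DiffersOnlyAt-sym (proj₂ (step x j)))
                                        (farApart x i≢j) far₂₄
      where
      d₃₄ : DiffersOnlyAt (c (flip j (flip i x))) (c (flip j x)) (proj₁ (step (flip j x) i))
      d₃₄ = DiffersOnlyAt-sym (subst (λ y → DiffersOnlyAt (c (flip j x)) (c y) (proj₁ (step (flip j x) i)))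
                                     (flip-comm i j x) (proj₂ (step (flip j x) i)))
      far₂₄ : FarApart _≟_ (c (flip i x)) (c (flip j x))
      far₂₄ = subst (λ y → FarApart _≟_ (c (flip i x)) (c (flip j y))) (flip-involutive i x) (farApart (flip i x) i≢j)

  along-flip-other : ∀ {i j} x → i ≢ j → Along i x → Along i (flip j x)
  along-flip-other {i} {j} x i≢j (d₁₂ , at-x , at-flip-x) with square-at x i≢j d₁₂
  ... | _ , d₄₃ , c₄≡c₁ , c₃≡c₂ =
      subst (λ y → DiffersOnlyAt (c (flip j x)) (c y) (v i)) (sym (flip-comm i j x)) d₄₃
    , trans c₄≡c₁ (trans at-x (cong (if_then β i else α i) (sym x-at-i)))
    , trans (cong (λ y → lookup (c y) (v i)) (flip-comm i j x))
            (trans c₃≡c₂ (trans at-flip-x (cong (if_then α i else β i) (sym x-at-i))))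
    where
    x-at-i : lookup (flip j x) i ≡ lookup x i
    x-at-i = Vec.lookup∘updateAt′ i j i≢j x

  along-flip-same : ∀ i x → Along i x → Along i (flip i x)
  along-flip-same i x (d₁₂ , at-x , at-flip-x) =
      subst (λ y → DiffersOnlyAt (c (flip i x)) (c y) (v i)) (sym (flip-involutive i x)) (DiffersOnlyAt-sym d₁₂)
    , trans at-flip-x (trans (sym (Bool.if-not (lookup x i))) (cong (if_then β i else α i) (sym (Vec.lookup∘updateAt i x))))
    , trans (cong (λ y → lookup (c y) (v i)) (flip-involutive i x))
            (trans at-x (trans (sym (Bool.if-not (lookup x i))) (cong (if_then α i else β i) (sym (Vec.lookup∘updateAt i x)))))

  along : ∀ i x → Along i x
  along i = cube-induction (Along i) (along-origin i) along-flip
    where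
    along-flip : ∀ x j → Along i x → Along i (flip j x)
    along-flip x j with i Fin.≟ j
    ... | yes refl = along-flip-same i x
    ... | no i≢j   = along-flip-other x i≢j

  coordinate : ∀ x i → lookup (c x) (v i) ≡ (if lookup x i then β i else α i)
  coordinate x i = proj₁ (proj₂ (along i x))

  α≢β : ∀ i → α i ≢ β i
  α≢β i = differs (proj₂ (step origin i))

  v-injective : ∀ i j → v i ≡ v j → i ≡ j
  v-injective i j vi≡vj with i Fin.≟ j
  ... | yes i≡j = i≡j
  ... | no i≢j  = contradiction (trans w≡vj (sym vi≡vj)) (proj₁ (square-at origin i≢j (proj₁ (along i origin))))
    where
    w≡vj : proj₁ (step (flip i origin) j) ≡ v j
    w≡vj = DiffersOnlyAt-unique (proj₂ (step (flip i origin) j)) (proj₁ (along j (flip i origin)))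

  constant-off : ∀ u → (∀ i → v i ≢ u) → ∀ x → lookup (c x) u ≡ lookup (c origin) u
  constant-off u off = cube-induction (λ x → lookup (c x) u ≡ lookup (c origin) u) refl
    (λ x j at-x → trans (sym (agrees (proj₁ (along j x)) u (off j ∘ sym))) at-x)

-- Induced cubes of the colouring graph are boxes

χ-any? : ∀ {d} {P : Fin d → Set} (P? : Decidable P) → (∀ {i j} → P i → P j → i ≡ j) →
  χ (Fin.any? P?) ≡ ∑[ i < d ] χ (P? i)
χ-any? {zero}  P? _      = refl
χ-any? {suc d} P? unique with P? zero
... | yes p₀ = cong suc (sym (trans (sum-cong-≗ (λ i → χ-no (P? (suc i)) (λ pᵢ → 0≢suc (unique p₀ pᵢ)))) (sum-replicate-zero d)))
  where
  0≢suc : ∀ {i : Fin d} → zero ≢ suc i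
  0≢suc ()
... | no _ = χ-any? (P? ∘ suc) (λ p q → Fin.suc-injective (unique p q))

image : ∀ {d N} → (Fin d → Fin N) → Subset N
image v = tabulate (λ u → does (Fin.any? (λ i → v i Fin.≟ u)))

∣image∣ : ∀ {d N} (v : Fin d → Fin N) → (∀ i j → v i ≡ v j → i ≡ j) → ∣ image v ∣ ≡ d
∣image∣ {d} {N} v v-injective = begin
  ∣ image v ∣
    ≡⟨ ∣∣-as-∑ (image v) ⟩
  ∑[ u < N ] 𝟙 (lookup (image v) u)
    ≡⟨ sum-cong-≗ (λ u → cong 𝟙 (Vec.lookup∘tabulate (λ u → does (Fin.any? (λ i → v i Fin.≟ u))) u)) ⟩
  ∑[ u < N ] χ (Fin.any? (λ i → v i Fin.≟ u))
    ≡⟨ sum-cong-≗ (λ u → χ-any? (λ i → v i Fin.≟ u) (λ p q → v-injective _ _ (trans p (sym q)))) ⟩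
  ∑[ u < N ] ∑[ i < d ] χ (v i Fin.≟ u)
    ≡⟨ ∑-comm (λ u i → χ (v i Fin.≟ u)) ⟩
  ∑[ i < d ] ∑[ u < N ] χ (v i Fin.≟ u)
    ≡⟨ sum-cong-≗ (λ i → trans (sum-cong-≗ (λ u → sym-χ i u)) (∑-pick (v i) (λ _ → 1))) ⟩
  ∑[ i < d ] 1
    ≡⟨ ∑-const d ⟩
  d ∎
  where
  sym-χ : ∀ i u → χ (v i Fin.≟ u) ≡ χ (u Fin.≟ v i) * 1
  sym-χ i u = trans (χ-cong (v i Fin.≟ u) (u Fin.≟ v i) sym sym) (sym (*-identityʳ _))

module _ {k : ℕ} where

  sortedPair : Fin k → Fin k → State k
  sortedPair a b with a Fin.≤? b
  ... | yes _ = a , b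
  ... | no _  = b , a

  ∈ₛ-sortedPair⁺ : ∀ {a b x} → x ≡ a ⊎ x ≡ b → x ∈ₛ sortedPair a b
  ∈ₛ-sortedPair⁺ {a} {b} x∈ with a Fin.≤? b
  ... | yes _ = x∈
  ... | no _  = Sum.swap x∈

  ∈ₛ-sortedPair⁻ : ∀ {a b x} → x ∈ₛ sortedPair a b → x ≡ a ⊎ x ≡ b
  ∈ₛ-sortedPair⁻ {a} {b} x∈ with a Fin.≤? b
  ... | yes _ = x∈
  ... | no _  = Sum.swap x∈

  sortedPair-∈-states : ∀ {a b} → a ≢ b → sortedPair a b ∈ states k true
  sortedPair-∈-states {a} {b} a≢b with a Fin.≤? b
  ... | yes a≤b = ∈-states-true⁺ (Fin.≤∧≢⇒< a≤b a≢b)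
  ... | no  a≰b = ∈-states-true⁺ (≰⇒> a≰b)

module _ {N : ℕ} (G : SimpleGraph N) (k d : ℕ) (U : Subset (nCols G k)) (iso : InducedIsoQ G k d U) where
  open SimpleGraph G using (Adj; irrefl)

  private
    φ : Vec Bool d → Fin (nCols G k)
    φ = proj₁ iso

    c : Vec Bool d → Vec (Fin k) N
    c x = col G k (φ x)

    c-injective : ∀ x y → c x ≡ c y → x ≡ y
    c-injective x y e = proj₁ (proj₂ iso) x y (col-injective G k (φ x) (φ y) e)

    c-adjacent : ∀ x y → ∃ (DiffersOnlyAt x y) → ∃ (DiffersOnlyAt (c x) (c y))
    c-adjacent x y (i , diff) = hamming≡1⇒differsOnlyAt Fin._≟_ (c x) (c y)
      (Equivalence.to (proj₂ (proj₂ (proj₂ iso)) x y) (differsOnlyAt⇒hamming≡1 Bool._≟_ x y i diff))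

    c-adjacent⁻ : ∀ x y → ∃ (DiffersOnlyAt (c x) (c y)) → ∃ (DiffersOnlyAt x y)
    c-adjacent⁻ x y (u , diff) = hamming≡1⇒differsOnlyAt Bool._≟_ x y
      (Equivalence.from (proj₂ (proj₂ (proj₂ iso)) x y) (differsOnlyAt⇒hamming≡1 Fin._≟_ (c x) (c y) u diff))

    open InducedCube Fin._≟_ c c-injective c-adjacent c-adjacent⁻

    base : Vec (Fin k) N
    base = c origin

    direction? : ∀ u → Dec (∃ λ i → v i ≡ u)
    direction? u = Fin.any? (λ i → v i Fin.≟ u)

    stateAt : ∀ u → Dec (∃ λ i → v i ≡ u) → State k
    stateAt u (yes (i , _)) = sortedPair (α i) (β i)
    stateAt u (no _)        = lookup base u , lookup base u

    s : Vec (State k) N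
    s = tabulate (λ u → stateAt u (direction? u))

    lookup-s : ∀ u → lookup s u ≡ stateAt u (direction? u)
    lookup-s u = Vec.lookup∘tabulate (λ u → stateAt u (direction? u)) u

    inStates : InStates G k (image v) s
    inStates u = subst₂ _∈_ (sym (lookup-s u)) (cong (states k) (sym (Vec.lookup∘tabulate _ u))) (at (direction? u))
      where
      at : (dir : Dec (∃ λ i → v i ≡ u)) → stateAt u dir ∈ states k (does dir)
      at (yes (i , _)) = sortedPair-∈-states (α≢β i)
      at (no _)        = ∈-states-false⁺ (lookup base u)

    c-inBox : ∀ x → InBox G k s (c x)
    c-inBox x u = subst (lookup (c x) u ∈ₛ_) (sym (lookup-s u)) (at (direction? u))
      where
      at : (dir : Dec (∃ λ i → v i ≡ u)) → lookup (c x) u ∈ₛ stateAt u dir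
      at (yes (i , refl)) = ∈ₛ-sortedPair⁺ (if-cases (lookup x i) (coordinate x i))
        where
        if-cases : ∀ b → lookup (c x) (v i) ≡ (if b then β i else α i) → lookup (c x) (v i) ≡ α i ⊎ lookup (c x) (v i) ≡ β i
        if-cases true  e = inj₂ e
        if-cases false e = inj₁ e
      at (no off) = inj₁ (constant-off u (λ i e → off (i , e)) x)

    inBox⇒cube : ∀ t → InBox G k s t → ∃ λ x → c x ≡ t
    inBox⇒cube t t∈ = x , vec-ext (λ u → at u (direction? u) (subst (lookup t u ∈ₛ_) (lookup-s u) (t∈ u)))
      where
      x : Vec Bool d
      x = tabulate (λ i → does (lookup t (v i) Fin.≟ β i))
      at : ∀ u (dir : Dec (∃ λ i → v i ≡ u)) → lookup t u ∈ₛ stateAt u dir → lookup (c x) u ≡ lookup t u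
      at u (yes (i , refl)) t∈ = trans (coordinate x i) (trans (cong (if_then β i else α i) (Vec.lookup∘tabulate _ i))
                                                               (choose (lookup t (v i) Fin.≟ β i) (∈ₛ-sortedPair⁻ t∈)))
        where
        choose : (β? : Dec (lookup t (v i) ≡ β i)) → lookup t (v i) ≡ α i ⊎ lookup t (v i) ≡ β i →
                 (if does β? then β i else α i) ≡ lookup t (v i)
        choose (yes t≡β) _          = sym t≡β
        choose (no _)    (inj₁ t≡α) = sym t≡α
        choose (no t≢β)  (inj₂ t≡β) = contradiction t≡β t≢β
      at u (no off) t∈ = trans (constant-off u (λ i e → off (i , e)) x) (sym (Sum.reduce t∈))

    box-colours-distinct : ∀ {u w a a′} → Adj u w → a ∈ₛ lookup s u → a′ ∈ₛ lookup s w → a ≢ a′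
    box-colours-distinct {u} {w} {a} {a′} auw a∈ a′∈ a≡a′ = col-proper G k (φ x) u w auw (begin
      lookup (c x) u   ≡⟨ cong (λ y → lookup y u) cx≡t ⟩
      lookup t u       ≡⟨ t-at-u ⟩
      a                ≡⟨ a≡a′ ⟩
      a′               ≡⟨ sym (Vec.lookup∘updateAt w t₀) ⟩
      lookup t w       ≡⟨ cong (λ y → lookup y w) (sym cx≡t) ⟩
      lookup (c x) w   ∎)
      where
      u≢w : u ≢ w
      u≢w refl = irrefl auw
      t₀ = base [ u ]≔ a
      t  = t₀ [ w ]≔ a′
      t-at-u : lookup t u ≡ a
      t-at-u = trans (Vec.lookup∘updateAt′ u w u≢w t₀) (Vec.lookup∘updateAt u base)
      t∈ : InBox G k s t
      t∈ z with z Fin.≟ w | z Fin.≟ u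
      ... | yes refl | _        = subst (_∈ₛ lookup s z) (sym (Vec.lookup∘updateAt z t₀)) a′∈
      ... | no z≢w   | yes refl = subst (_∈ₛ lookup s z) (sym t-at-u) a∈
      ... | no z≢w   | no z≢u   = subst (_∈ₛ lookup s z)
                                    (sym (trans (Vec.lookup∘updateAt′ z w z≢w t₀) (Vec.lookup∘updateAt′ z u z≢u base)))
                                    (c-inBox origin z)
      x = proj₁ (inBox⇒cube t t∈)
      cx≡t = proj₂ (inBox⇒cube t t∈)

    compatible : Compatible G (Disjoint k) s
    compatible u w auw = box-colours-distinct auw (inj₁ refl) (inj₁ refl) , box-colours-distinct auw (inj₁ refl) (inj₂ refl)
                       , box-colours-distinct auw (inj₂ refl) (inj₁ refl) , box-colours-distinct auw (inj₂ refl) (inj₂ refl)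

    box≡U : box G k s ≡ U
    box≡U = vec-ext (λ i → trans (lookup-box G k s i) (decide i (inBox? G k s (col G k i))))
      where
      decide : ∀ i (p : Dec (InBox G k s (col G k i))) → does p ≡ lookup U i
      decide i (yes p) with inBox⇒cube (col G k i) p
      ... | x , cx≡ci = sym (Vec.[]=⇒lookup (Equivalence.from (proj₁ (proj₂ (proj₂ iso)) i) (x , col-injective G k (φ x) i cx≡ci)))
      decide i (no ¬p) with lookup U i in Ui
      ... | false = refl
      ... | true with Equivalence.to (proj₁ (proj₂ (proj₂ iso)) i) (Vec.lookup⇒[]= i U Ui)
      ...   | x , refl = contradiction (c-inBox x) ¬p

  inducedCube⇒canonical : ∃ λ s → Canonical G k d s × box G k s ≡ U
  inducedCube⇒canonical = s , (image v , ∣image∣ v v-injective , inStates , compatible) , box≡U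

-- Boxes of canonical state vectors are induced cubes

enumerate : ∀ {N} (S : Subset N) → Fin ∣ S ∣ → Fin N
enumerate (true ∷ S)  zero    = zero
enumerate (true ∷ S)  (suc i) = suc (enumerate S i)
enumerate (false ∷ S) i       = suc (enumerate S i)

enumerate-injective : ∀ {N} (S : Subset N) i j → enumerate S i ≡ enumerate S j → i ≡ j
enumerate-injective (true ∷ S)  zero    zero    _ = refl
enumerate-injective (true ∷ S)  (suc i) (suc j) e = cong suc (enumerate-injective S i j (Fin.suc-injective e))
enumerate-injective (false ∷ S) i       j       e = enumerate-injective S i j (Fin.suc-injective e)

enumerate-∈ : ∀ {N} (S : Subset N) i → lookup S (enumerate S i) ≡ true
enumerate-∈ (true ∷ S)  zero    = refl
enumerate-∈ (true ∷ S)  (suc i) = enumerate-∈ S i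
enumerate-∈ (false ∷ S) i       = enumerate-∈ S i

enumerate-onto : ∀ {N} (S : Subset N) u → lookup S u ≡ true → ∃ λ i → enumerate S i ≡ u
enumerate-onto (true ∷ S)  zero    _   = zero , refl
enumerate-onto (true ∷ S)  (suc u) u∈S with enumerate-onto S u u∈S
... | i , refl = suc i , refl
enumerate-onto (false ∷ S) (suc u) u∈S with enumerate-onto S u u∈S
... | i , refl = i , refl

if-injective : ∀ {A : Set} {p q : A} → q ≢ p → ∀ a b → (if a then p else q) ≡ (if b then p else q) → a ≡ b
if-injective _   true  true  _ = refl
if-injective _   false false _ = refl
if-injective q≢p true  false e = contradiction (sym e) q≢p
if-injective q≢p false true  e = contradiction e q≢p

module _ {N : ℕ} (G : SimpleGraph N) (k : ℕ) {S : Subset N} {s : Vec (State k) N}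
         (inStates : InStates G k S s) (compatible : Compatible G (Disjoint k) s) where

  private
    d = ∣ S ∣

    v : Fin d → Fin N
    v = enumerate S

    lo hi : Fin N → Fin k
    lo u = proj₁ (lookup s u)
    hi u = proj₂ (lookup s u)

    lo≢hi : ∀ i → lo (v i) ≢ hi (v i)
    lo≢hi i = Fin.<⇒≢ (∈-states-true⁻ (subst (λ b → lookup s (v i) ∈ states k b) (enumerate-∈ S i) (inStates (v i))))

    lo≡hi : ∀ u → (∀ i → v i ≢ u) → lo u ≡ hi u
    lo≡hi u off with lookup S u in u∈? | inStates u
    ... | true  | _  = contradiction (proj₂ (enumerate-onto S u u∈?)) (off _)
    ... | false | t∈ = ∈-states-false⁻ t∈

    direction? : ∀ u → Dec (∃ λ i → v i ≡ u)
    direction? u = Fin.any? (λ i → v i Fin.≟ u)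

    colourAt : Vec Bool d → ∀ u → Dec (∃ λ i → v i ≡ u) → Fin k
    colourAt x u (yes (i , _)) = if lookup x i then hi u else lo u
    colourAt x u (no _)        = lo u

    vertex : Vec Bool d → Vec (Fin k) N
    vertex x = tabulate (λ u → colourAt x u (direction? u))

    lookup-vertex : ∀ x u → lookup (vertex x) u ≡ colourAt x u (direction? u)
    lookup-vertex x u = Vec.lookup∘tabulate (λ u → colourAt x u (direction? u)) u

    vertex-at : ∀ x j → lookup (vertex x) (v j) ≡ (if lookup x j then hi (v j) else lo (v j))
    vertex-at x j = trans (lookup-vertex x (v j)) (at (direction? (v j)))
      where
      at : (dir : Dec (∃ λ i → v i ≡ v j)) → colourAt x (v j) dir ≡ (if lookup x j then hi (v j) else lo (v j))
      at (yes (i , vi≡vj)) with refl ← enumerate-injective S i j vi≡vj = refl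
      at (no off) = contradiction (j , refl) off

    vertex-off : ∀ x y u → (∀ i → v i ≢ u) → lookup (vertex x) u ≡ lookup (vertex y) u
    vertex-off x y u off = trans (lookup-vertex x u) (trans (at (direction? u)) (sym (lookup-vertex y u)))
      where
      at : (dir : Dec (∃ λ i → v i ≡ u)) → colourAt x u dir ≡ colourAt y u dir
      at (yes (i , vi≡u)) = contradiction vi≡u (off i)
      at (no _)           = refl

    vertex-inBox : ∀ x → InBox G k s (vertex x)
    vertex-inBox x u = subst (_∈ₛ lookup s u) (sym (lookup-vertex x u)) (at (direction? u))
      where
      at : (dir : Dec (∃ λ i → v i ≡ u)) → colourAt x u dir ∈ₛ lookup s u
      at (yes (i , _)) with lookup x i
      ... | true  = inj₂ refl
      ... | false = inj₁ refl
      at (no _) = inj₁ refl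

    vertex-coordinate : ∀ {x y} j → lookup (vertex x) (v j) ≡ lookup (vertex y) (v j) → lookup x j ≡ lookup y j
    vertex-coordinate {x} {y} j e = if-injective (lo≢hi j) (lookup x j) (lookup y j) (trans (sym (vertex-at x j)) (trans e (vertex-at y j)))

    vertex-injective : ∀ x y → vertex x ≡ vertex y → x ≡ y
    vertex-injective x y e = vec-ext (λ j → vertex-coordinate j (cong (λ c → lookup c (v j)) e))

    inBox⇒vertex : ∀ t → InBox G k s t → ∃ λ x → vertex x ≡ t
    inBox⇒vertex t t∈ = x , vec-ext (λ u → trans (lookup-vertex x u) (at u (direction? u)))
      where
      x : Vec Bool d
      x = tabulate (λ j → does (lookup t (v j) Fin.≟ hi (v j)))
      at : ∀ u (dir : Dec (∃ λ i → v i ≡ u)) → colourAt x u dir ≡ lookup t u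
      at u (yes (j , refl)) = trans (cong (if_then hi (v j) else lo (v j)) (Vec.lookup∘tabulate _ j))
                                    (choose (lookup t (v j) Fin.≟ hi (v j)) (t∈ (v j)))
        where
        choose : (hi? : Dec (lookup t (v j) ≡ hi (v j))) → lookup t (v j) ∈ₛ lookup s (v j) →
                 (if does hi? then hi (v j) else lo (v j)) ≡ lookup t (v j)
        choose (yes t≡hi) _          = sym t≡hi
        choose (no _)     (inj₁ t≡lo) = sym t≡lo
        choose (no t≢hi)  (inj₂ t≡hi) = contradiction t≡hi t≢hi
      at u (no off) with t∈ u
      ... | inj₁ t≡lo = sym t≡lo
      ... | inj₂ t≡hi = trans (lo≡hi u (λ i e → off (i , e))) (sym t≡hi)

    vertex-differs⁺ : ∀ x y i → DiffersOnlyAt x y i → DiffersOnlyAt (vertex x) (vertex y) (v i)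
    vertex-differs⁺ x y i ⟨ x≢y , agree ⟩ = ⟨ x≢y ∘ vertex-coordinate i , agree′ ⟩
      where
      agree′ : ∀ u → u ≢ v i → lookup (vertex x) u ≡ lookup (vertex y) u
      agree′ u u≢vi = trans (lookup-vertex x u) (trans (at (direction? u)) (sym (lookup-vertex y u)))
        where
        at : (dir : Dec (∃ λ j → v j ≡ u)) → colourAt x u dir ≡ colourAt y u dir
        at (yes (j , refl)) = cong (if_then hi (v j) else lo (v j)) (agree j (λ j≡i → u≢vi (cong v j≡i)))
        at (no _)           = refl

    vertex-differs⁻ : ∀ x y u → DiffersOnlyAt (vertex x) (vertex y) u → ∃ (DiffersOnlyAt x y)
    vertex-differs⁻ x y u ⟨ x≢y , agree ⟩ with direction? u
    ... | no off = contradiction (vertex-off x y u (λ i e → off (i , e))) x≢y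
    ... | yes (i , refl) = i , ⟨ (λ e → x≢y (trans (vertex-at x i) (trans (cong (if_then hi (v i) else lo (v i)) e) (sym (vertex-at y i)))))
                               , (λ j j≢i → vertex-coordinate j (agree (v j) (j≢i ∘ enumerate-injective S j i))) ⟩

    φ : Vec Bool d → Fin (nCols G k)
    φ x = proj₁ (col-surjective G k (vertex x) (inBox⇒proper G k {s} {vertex x} compatible (vertex-inBox x)))

    col-φ : ∀ x → col G k (φ x) ≡ vertex x
    col-φ x = proj₂ (col-surjective G k (vertex x) (inBox⇒proper G k {s} {vertex x} compatible (vertex-inBox x)))

    φ-injective : ∀ x y → φ x ≡ φ y → x ≡ y
    φ-injective x y e = vertex-injective x y (trans (sym (col-φ x)) (trans (cong (col G k) e) (col-φ y)))

    box⇔image : ∀ i → i Subset.∈ box G k s ⇔ ∃ (λ x → φ x ≡ i)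
    box⇔image i = mk⇔ to from
      where
      to : i Subset.∈ box G k s → ∃ (λ x → φ x ≡ i)
      to i∈ with inBox⇒vertex (col G k i) (does-true⇒ (inBox? G k s (col G k i)) (trans (sym (lookup-box G k s i)) (Vec.[]=⇒lookup i∈)))
      ... | x , vx≡ci = x , col-injective G k (φ x) i (trans (col-φ x) vx≡ci)
      from : ∃ (λ x → φ x ≡ i) → i Subset.∈ box G k s
      from (x , refl) = Vec.lookup⇒[]= (φ x) (box G k s)
        (trans (lookup-box G k s (φ x)) (dec-true (inBox? G k s (col G k (φ x))) (subst (InBox G k s) (sym (col-φ x)) (vertex-inBox x))))

    adjacent⇔ : ∀ x y → QAdj x y ⇔ CAdj G k (φ x) (φ y)
    adjacent⇔ x y = mk⇔ to from
      where
      to : QAdj x y → CAdj G k (φ x) (φ y)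
      to q with i , diff ← hamming≡1⇒differsOnlyAt Bool._≟_ x y q =
        subst₂ (λ a b → hamming Fin._≟_ a b ≡ 1) (sym (col-φ x)) (sym (col-φ y))
          (differsOnlyAt⇒hamming≡1 Fin._≟_ (vertex x) (vertex y) (v i) (vertex-differs⁺ x y i diff))
      from : CAdj G k (φ x) (φ y) → QAdj x y
      from q with u , diff ← hamming≡1⇒differsOnlyAt Fin._≟_ (vertex x) (vertex y)
                               (subst₂ (λ a b → hamming Fin._≟_ a b ≡ 1) (col-φ x) (col-φ y) q)
                 with i , diff′ ← vertex-differs⁻ x y u diff =
        differsOnlyAt⇒hamming≡1 Bool._≟_ x y i diff′

  box-inducedCube : InducedIsoQ G k ∣ S ∣ (box G k s)
  box-inducedCube = φ , φ-injective , box⇔image , adjacent⇔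

canonical⇒inducedCube : ∀ {N} (G : SimpleGraph N) k d {s} → Canonical G k d s → InducedIsoQ G k d (box G k s)
canonical⇒inducedCube G k d {s} (S , refl , inStates , compatible) = box-inducedCube G k {S} {s} inStates compatible

module _ {k : ℕ} where

  lower : ∀ {a b x : Fin k} → a Fin.≤ b → x ∈ₛ (a , b) → a Fin.≤ x
  lower a≤b (inj₁ refl) = Fin.≤-refl
  lower a≤b (inj₂ refl) = a≤b

  upper : ∀ {a b x : Fin k} → a Fin.≤ b → x ∈ₛ (a , b) → x Fin.≤ b
  upper a≤b (inj₁ refl) = a≤b
  upper a≤b (inj₂ refl) = Fin.≤-refl

  sortedPair-ext : ∀ {a₁ b₁ a₂ b₂ : Fin k} → a₁ Fin.≤ b₁ → a₂ Fin.≤ b₂ →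
    a₁ ∈ₛ (a₂ , b₂) → b₁ ∈ₛ (a₂ , b₂) → a₂ ∈ₛ (a₁ , b₁) → b₂ ∈ₛ (a₁ , b₁) → (a₁ , b₁) ≡ (a₂ , b₂)
  sortedPair-ext a₁≤b₁ a₂≤b₂ a₁∈ b₁∈ a₂∈ b₂∈ =
    cong₂ _,_ (Fin.≤-antisym (lower a₁≤b₁ a₂∈) (lower a₂≤b₂ a₁∈))
              (Fin.≤-antisym (upper a₂≤b₂ b₁∈) (upper a₁≤b₁ b₂∈))

module _ {N : ℕ} (G : SimpleGraph N) (k : ℕ) where

  InStates⇒sorted : ∀ {S s} → InStates G k S s → ∀ u → proj₁ (lookup s u) Fin.≤ proj₂ (lookup s u)
  InStates⇒sorted {S} inStates u with lookup S u | inStates u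
  ... | true  | t∈ = <⇒≤ (∈-states-true⁻ t∈)
  ... | false | t∈ = Fin.≤-reflexive (∈-states-false⁻ t∈)

  box-transfer : ∀ {s₁ s₂} → Compatible G (Disjoint k) s₁ → box G k s₁ ≡ box G k s₂ → ∀ c → InBox G k s₁ c → InBox G k s₂ c
  box-transfer {s₁} {s₂} compatible box≡ c c∈ with col-surjective G k c (inBox⇒proper G k {s₁} {c} compatible c∈)
  ... | i , refl = does-true⇒ (inBox? G k s₂ (col G k i)) (begin
    does (inBox? G k s₂ (col G k i))   ≡⟨ sym (lookup-box G k s₂ i) ⟩
    lookup (box G k s₂) i              ≡⟨ cong (λ U → lookup U i) (sym box≡) ⟩
    lookup (box G k s₁) i              ≡⟨ lookup-box G k s₁ i ⟩
    does (inBox? G k s₁ (col G k i))   ≡⟨ dec-true (inBox? G k s₁ (col G k i)) c∈ ⟩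
    true                               ∎)

  box-injective : ∀ {d s₁ s₂} → Canonical G k d s₁ → Canonical G k d s₂ → box G k s₁ ≡ box G k s₂ → s₁ ≡ s₂
  box-injective {s₁ = s₁} {s₂} (S₁ , _ , in₁ , compatible₁) (S₂ , _ , in₂ , compatible₂) box≡ = vec-ext (λ u →
    sortedPair-ext (InStates⇒sorted {S₁} {s₁} in₁ u) (InStates⇒sorted {S₂} {s₂} in₂ u)
      (component s₁ s₂ proj₁ box≡ compatible₁ (λ u → inj₁ refl) u)
      (component s₁ s₂ proj₂ box≡ compatible₁ (λ u → inj₂ refl) u)
      (component s₂ s₁ proj₁ (sym box≡) compatible₂ (λ u → inj₁ refl) u)
      (component s₂ s₁ proj₂ (sym box≡) compatible₂ (λ u → inj₂ refl) u))
    where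
    component : ∀ s s′ (f : State k → Fin k) → box G k s ≡ box G k s′ → Compatible G (Disjoint k) s →
      (∀ u → f (lookup s u) ∈ₛ lookup s u) → ∀ u → f (lookup s u) ∈ₛ lookup s′ u
    component s s′ f box≡ compatible f∈ u = subst (_∈ₛ lookup s′ u) (Vec.lookup-map u f s)
      (box-transfer {s} {s′} compatible box≡ (Vec.map f s) (λ w → subst (_∈ₛ lookup s w) (sym (Vec.lookup-map w f s)) (f∈ w)) u)

module _ {N : ℕ} (G : SimpleGraph N) (k d : ℕ) where

  private
    L : List (Vec (State k) N)
    L = canonicalStates G k d

    boxOf? : (U : Subset (nCols G k)) → Dec (Any (λ s → box G k s ≡ U) L)
    boxOf? U = Any.any? (λ s → Vec.≡-dec Bool._≟_ (box G k s) U) L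

    inducedCube⇒boxOf : ∀ U → InducedIsoQ G k d U → Any (λ s → box G k s ≡ U) L
    inducedCube⇒boxOf U iso with s , canonical , box≡U ← inducedCube⇒canonical G k d U iso =
      lose (∈-canonicalStates⁺ G k {d} {s} canonical) box≡U

    toQ : Fin (length L) → QSubsets G k d
    toQ i = box G k (List.lookup L i)
          , [ canonical⇒inducedCube G k d {List.lookup L i} (∈-canonicalStates⁻ G k (∈-lookup i)) ]

    -- The isomorphism in QSubsets is irrelevant, so the state vector of U is found by searching L.
    indexOf : ∀ U → .(InducedIsoQ G k d U) → Dec (Any (λ s → box G k s ≡ U) L) → Fin (length L)
    indexOf U _   (yes found) = index found
    indexOf U iso (no ¬found) = Irrelevant.⊥-elim (¬found (inducedCube⇒boxOf U iso))

    fromQ : QSubsets G k d → Fin (length L)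
    fromQ (U , [ iso ]) = indexOf U iso (boxOf? U)

    QSubsets-≡ : ∀ {U U′} {p : Irrelevant (InducedIsoQ G k d U)} {q : Irrelevant (InducedIsoQ G k d U′)} →
      U ≡ U′ → _≡_ {A = QSubsets G k d} (U , p) (U′ , q)
    QSubsets-≡ refl = refl

    toQ∘fromQ : ∀ q → toQ (fromQ q) ≡ q
    toQ∘fromQ (U , [ iso ]) = go (boxOf? U)
      where
      go : (found? : Dec (Any (λ s → box G k s ≡ U) L)) → toQ (indexOf U iso found?) ≡ (U , [ iso ])
      go (yes found) = QSubsets-≡ (lookup-index found)
      go (no ¬found) = Irrelevant.⊥-elim (¬found (inducedCube⇒boxOf U iso))

    fromQ∘toQ : ∀ i → fromQ (toQ i) ≡ i
    fromQ∘toQ i = go (boxOf? (box G k (List.lookup L i)))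
      where
      canonical : ∀ j → Canonical G k d (List.lookup L j)
      canonical j = ∈-canonicalStates⁻ G k (∈-lookup j)
      go : (found? : Dec (Any (λ s → box G k s ≡ box G k (List.lookup L i)) L)) →
           indexOf (box G k (List.lookup L i)) (canonical⇒inducedCube G k d {List.lookup L i} (canonical i)) found? ≡ i
      go (yes found) = lookup-injective (canonicalStates-unique G k d) (index found) i
                         (box-injective G k {d} {List.lookup L (index found)} {List.lookup L i}
                                        (canonical (index found)) (canonical i) (lookup-index found))
      go (no ¬found) = ⊥-elim (¬found (lose (∈-lookup i) refl))

  canonicalStates↔inducedCubes : Fin (length (canonicalStates G k d)) ↔ QSubsets G k d
  canonicalStates↔inducedCubes = mk↔ₛ′ toQ fromQ toQ∘fromQ fromQ∘toQ

sumℤ-map : ∀ {A : Set} (c : ℕ) (f : A → ℤ) (g : A → ℕ) (xs : List A) →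
  (∀ {x} → x ∈ xs → f x ≡ + (c * g x)) → sumℤ (map f xs) ≡ + (c * listSum xs g)
sumℤ-map c f g []       _  = cong +_ (sym (*-zeroʳ c))
sumℤ-map c f g (x ∷ xs) fx = begin
  f x ℤ.+ sumℤ (map f xs)               ≡⟨ cong₂ ℤ._+_ (fx (here refl)) (sumℤ-map c f g xs (fx ∘ there)) ⟩
  + (c * g x) ℤ.+ + (c * listSum xs g)  ≡⟨ sym (ℤ.pos-+ (c * g x) (c * listSum xs g)) ⟩
  + (c * g x + c * listSum xs g)        ≡⟨ cong +_ (sym (*-distribˡ-+ c (g x) (listSum xs g))) ⟩
  + (c * (g x + listSum xs g))          ∎

canonicalStates-count : ∀ {n} (T : SimpleGraph n) → IsTree T → ∀ d → 1 ≤ d → ∀ k → 1 ≤ k →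
  + (2 ^ d * length (canonicalStates T k d)) ≡ treeSum T k d
canonicalStates-count {n} T tree d 1≤d k 1≤k = begin
  + (2 ^ d * length (canonicalStates T k d))
    ≡⟨ cong (λ m → + (2 ^ d * m)) (length-canonicalStates T k d) ⟩
  + (2 ^ d * ∑[ S ∈ sizedSubsets n d ] length (compatibleStates T k S))
    ≡⟨ sym (sumℤ-map (2 ^ d) (term T k d) (λ S → length (compatibleStates T k S)) (sizedSubsets n d) term-count) ⟩
  treeSum T k d ∎
  where
  term-count : ∀ {S} → S ∈ sizedSubsets n d → term T k d S ≡ + (2 ^ d * length (compatibleStates T k S))
  term-count {S} S∈ with refl ← proj₂ (∈-filter⁻ (λ S → ∣ S ∣ ℕ.≟ d) {xs = allSubsets n} S∈) =
    sym (tree-identity T tree k 1≤k S 1≤d)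

theorem4p3 : ∀ {n : ℕ} (T : SimpleGraph n) → IsTree T →
    ∀ (d : ℕ) → 1 ≤ d → ∀ (k : ℕ) → 1 ≤ k →
    Σ ℕ (λ N → PiQ≡ T k d N × (+ (2 ^ d * N) ≡ treeSum T k d))
theorem4p3 T tree d 1≤d k 1≤k =
  length (canonicalStates T k d) , canonicalStates↔inducedCubes T k d , canonicalStates-count T tree d 1≤d k 1≤k
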